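{- Let $0<k<n$ be integers and let $r$ be an integer with $1\le r\le \lfloor n/k\rfloor$. Let $\nabla_{n,k}$ be the (circuit) triangulation of the hypersimplex $\Delta_{n,k}$ described in the context. Then the simplices $\sigma_{\mathcal I}\in\nabla_{n,k}$ for which every member of the sorted collection $\mathcal I$ is an $r$-stable $k$-subset of $[n]$ form a triangulation of the $r$-stable hypersimplex $\Delta_{n,k}^{stab(r)}$. That is, $\nabla_{n,k}$ restricts to a triangulation of $\Delta_{n,k}^{stab(r)}$.
   Context: For a $k$-subset $I\subseteq[n]=\{1,\dots,n\}$, $\epsilon_I\in\{0,1\}^n$ is its characteristic vector. The hypersimplex $\Delta_{n,k}$ is the convex hull of all $\epsilon_I$ with $|I|=k$. Place $1,\dots,n$ clockwise on the vertices of a regular $n$-gon; the circular distance $\mathrm{cd}(i,j)$ is the number of edges on the shortest path between $i$ and $j$ in this $n$-gon. A subset $S\subseteq[n]$ is $r$-stable if $\mathrm{cd}(i,j)\ge r$ for all distinct $i,j\in S$. The $r$-stable hypersimplex $\Delta_{n,k}^{stab(r)}$ is the convex hull of the $\epsilon_I$ over all $r$-stable $k$-subsets $I$ of $[n]$. For $k$-subsets $I,J$, let $(a_1\le a_2\le\dots\le a_{2k})$ be the elements of the multiset union $I\cup J$ in nondecreasing order, $U(I,J)=\{a_1,a_3,\dots,a_{2k-1}\}$, $V(I,J)=\{a_2,a_4,\dots,a_{2k}\}$. The pair $(I,J)$ is sorted if $I=U(I,J)$ and $J=V(I,J)$; an ordered collection $\mathcal I=(I_1,\dots,I_d)$ of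 $k$-subsets is sorted if $(I_i,I_j)$ is sorted for all $i<j$, and $\sigma_{\mathcal I}$ denotes the simplex with vertices $\epsilon_{I_1},\dots,\epsilon_{I_d}$. It is known (Sturmfels; Lam–Postnikov) that the simplices $\sigma_{\mathcal I}$, over all sorted collections, form a regular unimodular triangulation $\nabla_{n,k}$ of $\Delta_{n,k}$, called the circuit triangulation.
   Formalization: The geometry is taken over ℚ: points of $\Delta_{n,k}^{stab(r)}$ and of the simplices $\sigma_{\mathcal I}$ have rational coordinates, and the coefficients of convex combinations and of affine dependences are rational. -}

module Defs where

open import Data.Nat as ℕ using (ℕ; zero; suc; _≤_; _≤ᵇ_; ∣_-_∣; _⊓_; _∸_)
open import Data.Fin using (Fin; toℕ)
open import Data.Fin.Subset using (Subset; _∈_; ∣_∣)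
open import Data.Bool using (Bool; true; false; if_then_else_)
open import Data.Vec using ([]; _∷_)
open import Data.List using (List; []; _∷_; map; zipWith; length; foldr)
open import Data.List.Relation.Unary.All using (All)
open import Data.List.Relation.Unary.AllPairs using (AllPairs)
open import Data.List.Relation.Binary.Sublist.Propositional using (_⊆_)
import Data.List.Membership.Propositional as LM
open import Data.Rational using (ℚ; 0ℚ; 1ℚ; _*_; _+_) renaming (_≤_ to _≤ℚ_)
open import Data.Product using (Σ; _×_; ∃)
open import Relation.Binary.PropositionalEquality using (_≡_; _≢_)

-- Points of ℚ^n and convex hulls.  (All vertices are 0/1 vectors, so
-- working over ℚ instead of ℝ is faithful.)

sumℚ : List ℚ → ℚ
sumℚ = foldr _+_ 0ℚ

Point : ℕ → Set
Point n = Fin n → ℚ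

lincomb : ∀ {n} → List ℚ → List (Point n) → Point n
lincomb ls vs i = sumℚ (zipWith (λ l v → l * v i) ls vs)

InConv : ∀ {n} → List (Point n) → Point n → Set
InConv {n} vs x =
  Σ (List ℚ) λ ls →
    (length ls ≡ length vs) × All (0ℚ ≤ℚ_) ls × (sumℚ ls ≡ 1ℚ) ×
    ((i : Fin n) → x i ≡ lincomb ls vs i)

AffinelyIndependent : ∀ {n} → List (Point n) → Set
AffinelyIndependent {n} vs =
  (ls : List ℚ) → length ls ≡ length vs → sumℚ ls ≡ 0ℚ →
  ((i : Fin n) → lincomb ls vs i ≡ 0ℚ) → All (_≡ 0ℚ) ls

-- Subsets of [n] (the element i ∈ [n] is represented by Fin n, i ↦ i-1)

ε : ∀ {n} → Subset n → Point n
ε I i = if Data.Vec.lookup I i then 1ℚ else 0ℚ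
  where import Data.Vec

InConvHullOf : ∀ {n} → (Subset n → Set) → Point n → Set
InConvHullOf {n} V x = Σ (List (Subset n)) λ Is → All V Is × InConv (map ε Is) x

KSubset : (n k : ℕ) → Subset n → Set
KSubset n k I = ∣ I ∣ ≡ k

cd : ∀ {n} → Fin n → Fin n → ℕ
cd {n} i j = ∣ toℕ i - toℕ j ∣ ⊓ (n ∸ ∣ toℕ i - toℕ j ∣)

RStable : ∀ {n} → ℕ → Subset n → Set
RStable r S = ∀ i j → i ∈ S → j ∈ S → i ≢ j → r ≤ cd i j

StableKSubset : (n k r : ℕ) → Subset n → Set
StableKSubset n k r I = KSubset n k I × RStable r I

elems : ∀ {n} → Subset n → List ℕ
elems [] = []
elems (true ∷ p) = 0 ∷ map suc (elems p)
elems (false ∷ p) = map suc (elems p)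

merge : List ℕ → List ℕ → List ℕ
merge [] ys = ys
merge (x ∷ xs) [] = x ∷ xs
merge (x ∷ xs) (y ∷ ys) =
  if x ≤ᵇ y then x ∷ merge xs (y ∷ ys) else y ∷ merge (x ∷ xs) ys

odds evens : List ℕ → List ℕ
odds [] = []
odds (x ∷ xs) = x ∷ evens xs
evens [] = []
evens (x ∷ xs) = odds xs

U V : ∀ {n} → Subset n → Subset n → List ℕ
U I J = odds (merge (elems I) (elems J))
V I J = evens (merge (elems I) (elems J))

SortedPair : ∀ {n} → Subset n → Subset n → Set
SortedPair I J = (elems I ≡ U I J) × (elems J ≡ V I J)

SortedCollection : (n k : ℕ) → List (Subset n) → Set
SortedCollection n k C =
  All (KSubset n k) C × AllPairs (λ I J → (I ≢ J) × SortedPair I J) C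

-- simplices σ_𝓘 of ∇_{n,k} whose sorted collection consists of r-stable sets
StableSortedCollection : (n k r : ℕ) → List (Subset n) → Set
StableSortedCollection n k r C =
  SortedCollection n k C × All (StableKSubset n k r) C

-- Triangulation of the polytope conv{ε_I : Vert I} by the family of
-- simplices conv{ε_I : I ∈ C}, C ranging over lists with Simp C
-- (a geometric simplicial complex whose union is the polytope).

record IsTriangulation (n : ℕ) (Vert : Subset n → Set)
                       (Simp : List (Subset n) → Set) : Set where
  field
    vertices-in : ∀ C → Simp C → All Vert C
    simplex     : ∀ C → Simp C → AffinelyIndependent (map ε C)
    face-closed : ∀ C D → Simp C → D ⊆ C → Simp D
    covers      : ∀ x → InConvHullOf Vert x →
                  Σ (List (Subset n)) λ C → Simp C × InConv (map ε C) x
    intersect   : ∀ C C' x → Simp C → Simp C' →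
                  InConv (map ε C) x → InConv (map ε C') x →
                  Σ (List (Subset n)) λ D →
                    All (LM._∈ C) D × All (LM._∈ C') D × InConv (map ε D) x

module Submission where

-- Everything rests on prefix counts: prefix v I = #{i ∈ I : i < v}.
--  * SortedPairs: a pair (I , J) of k-sets is sorted iff it is balanced,
--    prefix v J ≤ prefix v I ≤ prefix v J + 1 for all v.
--  * BalancedLists: a pairwise balanced list of subsets is determined by
--    its length and its column counts (how many members contain each i).
--  * ClearingDenominators, Supports: with natural multiplicities, hence two
--    nonnegative representations of one point by balanced collections have
--    the same support.
--  * Simplices: so each σ_C is a simplex, and two of them meet in a face.
--  * CyclicFilling: conversely every vector of column counts ≤ N is
--    realised by a balanced list of N subsets, dealt out cyclically.
--  * Stability: if the counts come from N r-stable k-sets, every dealt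
--    subset is again an r-stable k-set (windows of length r are respected
--    on average, hence by every slot).
--  * Covering: so every point of the r-stable hypersimplex lies in a σ_C.

open import Defs
open import Data.Bool using (Bool; true; false)
open import Data.Vec as Vec using (Vec; []; _∷_; lookup)
open import Data.Fin using (Fin; toℕ)
open import Data.Fin.Subset using (Subset; ∣_∣)
open import Data.List using (List; []; _∷_; map; length)
open import Data.List.Properties using (length-map)
open import Data.List.Relation.Unary.All as All using (All; []; _∷_)
open import Data.List.Relation.Unary.AllPairs as AllPairs using (AllPairs; []; _∷_)
import Data.List.Relation.Unary.AllPairs.Properties as AllPairsₚ
open import Data.Product using (Σ; _×_; _,_; proj₁; proj₂; uncurry)
open import Data.Empty using (⊥; ⊥-elim)
open import Relation.Nullary using (yes; no; ¬_)
open import Relation.Binary.Definitions using (tri<; tri≈; tri>)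
open import Relation.Binary.PropositionalEquality

-- Sorted pairs are exactly the balanced pairs.
--
-- A pair (I , J) of k-subsets is sorted iff for every v
--     prefix v J ≤ prefix v I ≤ prefix v J + 1,
-- i.e. the elements of I and J alternate, starting with I.
module SortedPairs where

  open import Data.Nat using (ℕ; zero; suc; _≤_; _<_; z≤n; s≤s; _+_; _≤ᵇ_; _<?_)
  open import Data.Nat.Properties
  open import Data.Bool using (T)

  Ascending : List ℕ → Set
  Ascending = AllPairs _≤_

  below : ℕ → List ℕ → ℕ
  below v [] = 0
  below v (x ∷ xs) with x <? v
  ... | yes _ = suc (below v xs)
  ... | no _ = below v xs

  below-none : ∀ {v} xs → All (v ≤_) xs → below v xs ≡ 0
  below-none [] [] = refl
  below-none {v} (x ∷ xs) (v≤x ∷ v≤xs) with x <? v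
  ... | yes x<v = ⊥-elim (<⇒≱ x<v v≤x)
  ... | no _ = below-none xs v≤xs

  below-head : ∀ x xs → below (suc x) (x ∷ xs) ≢ 0
  below-head x xs with x <? suc x
  ... | yes _ = λ ()
  ... | no x≮1+x = ⊥-elim (x≮1+x ≤-refl)

  below-zero : ∀ xs → below 0 xs ≡ 0
  below-zero xs = below-none xs (All.tabulate (λ _ → z≤n))

  below-suc : ∀ v xs → below (suc v) (map suc xs) ≡ below v xs
  below-suc v [] = refl
  below-suc v (x ∷ xs) with suc x <? suc v | x <? v
  ... | yes _ | yes _ = cong suc (below-suc v xs)
  ... | no _ | no _ = below-suc v xs
  ... | yes 1+x<1+v | no x≮v = ⊥-elim (x≮v (≤-pred 1+x<1+v))
  ... | no 1+x≮1+v | yes x<v = ⊥-elim (1+x≮1+v (s≤s x<v))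

  ascending-ext : ∀ xs ys → Ascending xs → Ascending ys →
    (∀ v → below v xs ≡ below v ys) → xs ≡ ys
  ascending-ext [] [] _ _ _ = refl
  ascending-ext [] (y ∷ ys) _ _ same = ⊥-elim (below-head y ys (sym (same (suc y))))
  ascending-ext (x ∷ xs) [] _ _ same = ⊥-elim (below-head x xs (same (suc x)))
  ascending-ext (x ∷ xs) (y ∷ ys) (x≤xs ∷ xs↑) (y≤ys ∷ ys↑) same with <-cmp x y
  ... | tri< x<y _ _ = ⊥-elim (below-head x xs
        (trans (same (suc x)) (below-none (y ∷ ys) (x<y ∷ All.map (<-≤-trans x<y) y≤ys))))
  ... | tri> _ _ y<x = ⊥-elim (below-head y ys
        (trans (sym (same (suc y))) (below-none (x ∷ xs) (y<x ∷ All.map (<-≤-trans y<x) x≤xs))))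
  ... | tri≈ _ refl _ = cong (x ∷_) (ascending-ext xs ys xs↑ ys↑ (λ v → drop-head v (same v)))
    where
    drop-head : ∀ v → below v (x ∷ xs) ≡ below v (x ∷ ys) → below v xs ≡ below v ys
    drop-head v eq with x <? v
    ... | yes _ = suc-injective eq
    ... | no _ = eq

  All-odds : ∀ {P : ℕ → Set} xs → All P xs → All P (odds xs)
  All-evens : ∀ {P : ℕ → Set} xs → All P xs → All P (evens xs)
  All-odds [] _ = []
  All-odds (x ∷ xs) (px ∷ pxs) = px ∷ All-evens xs pxs
  All-evens [] _ = []
  All-evens (x ∷ xs) (_ ∷ pxs) = All-odds xs pxs

  odds-evens-below : ∀ v xs → Ascending xs →
    (below v (evens xs) ≤ below v (odds xs)) × (below v (odds xs) ≤ suc (below v (evens xs)))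
  odds-evens-below v [] _ = z≤n , z≤n
  odds-evens-below v (x ∷ xs) (x≤xs ∷ xs↑) with x <? v
  ... | yes _ = let (e≤o , o≤1+e) = odds-evens-below v xs xs↑ in o≤1+e , s≤s e≤o
  ... | no x≮v rewrite below-none (odds xs) (All-odds xs (All.map (≤-trans (≮⇒≥ x≮v)) x≤xs))
                     | below-none (evens xs) (All-evens xs (All.map (≤-trans (≮⇒≥ x≮v)) x≤xs)) = z≤n , z≤n

  merge-All : ∀ {P : ℕ → Set} xs ys → All P xs → All P ys → All P (merge xs ys)
  merge-All [] ys _ pys = pys
  merge-All {P} (x ∷ xs) ys (px ∷ pxs) = go ys
    where
    go : ∀ ys → All P ys → All P (merge (x ∷ xs) ys)
    go [] _ = px ∷ pxs
    go (y ∷ ys) (py ∷ pys) with x ≤ᵇ y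
    ... | true = px ∷ merge-All xs (y ∷ ys) pxs (py ∷ pys)
    ... | false = py ∷ go ys pys

  merge-ascending : ∀ xs ys → Ascending xs → Ascending ys → Ascending (merge xs ys)
  merge-ascending [] ys _ ys↑ = ys↑
  merge-ascending (x ∷ xs) ys (x≤xs ∷ xs↑) = go ys
    where
    go : ∀ ys → Ascending ys → Ascending (merge (x ∷ xs) ys)
    go [] _ = x≤xs ∷ xs↑
    go (y ∷ ys) (y≤ys ∷ ys↑) with x ≤ᵇ y in x≤ᵇy
    ... | true = merge-All xs (y ∷ ys) x≤xs (x≤y ∷ All.map (≤-trans x≤y) y≤ys)
                 ∷ merge-ascending xs (y ∷ ys) xs↑ (y≤ys ∷ ys↑)
      where
      x≤y : x ≤ y
      x≤y = ≤ᵇ⇒≤ x y (subst T (sym x≤ᵇy) _)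
    ... | false = merge-All (x ∷ xs) ys (y≤x ∷ All.map (≤-trans y≤x) x≤xs) y≤ys ∷ go ys ys↑
      where
      y≤x : y ≤ x
      y≤x = ≰⇒≥ (λ x≤y → subst T x≤ᵇy (≤⇒≤ᵇ x≤y))

  below-merge : ∀ v xs ys → below v (merge xs ys) ≡ below v xs + below v ys
  below-merge v [] ys = refl
  below-merge v (x ∷ xs) ys = go ys
    where
    go : ∀ ys → below v (merge (x ∷ xs) ys) ≡ below v (x ∷ xs) + below v ys
    go [] = sym (+-identityʳ _)
    go (y ∷ ys) with x ≤ᵇ y
    go (y ∷ ys) | true with x <? v
    ... | yes _ = cong suc (below-merge v xs (y ∷ ys))
    ... | no _ = below-merge v xs (y ∷ ys)
    go (y ∷ ys) | false with y <? v
    ... | yes _ = trans (cong suc (go ys)) (sym (+-suc _ _))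
    ... | no _ = go ys

  interleave : List ℕ → List ℕ → List ℕ
  interleave [] ys = ys
  interleave (x ∷ xs) [] = x ∷ xs
  interleave (x ∷ xs) (y ∷ ys) = x ∷ y ∷ interleave xs ys

  interleave-∷ : ∀ x xs ys → interleave (x ∷ xs) ys ≡ x ∷ interleave ys xs
  interleave-∷ x xs [] = refl
  interleave-∷ x xs (y ∷ ys) = cong (x ∷_) (sym (interleave-∷ y ys xs))

  interleave-suc : ∀ xs ys → interleave (map suc xs) (map suc ys) ≡ map suc (interleave xs ys)
  interleave-suc [] ys = refl
  interleave-suc (x ∷ xs) [] = refl
  interleave-suc (x ∷ xs) (y ∷ ys) = cong (λ zs → suc x ∷ suc y ∷ zs) (interleave-suc xs ys)

  below-interleave : ∀ v xs ys → below v (interleave xs ys) ≡ below v xs + below v ys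
  below-interleave v [] ys = refl
  below-interleave v (x ∷ xs) [] = sym (+-identityʳ _)
  below-interleave v (x ∷ xs) (y ∷ ys) with x <? v
  below-interleave v (x ∷ xs) (y ∷ ys) | yes _ with y <? v
  ... | yes _ = cong suc (trans (cong suc (below-interleave v xs ys)) (sym (+-suc _ _)))
  ... | no _ = cong suc (below-interleave v xs ys)
  below-interleave v (x ∷ xs) (y ∷ ys) | no _ with y <? v
  ... | yes _ = trans (cong suc (below-interleave v xs ys)) (sym (+-suc _ _))
  ... | no _ = below-interleave v xs ys

  odds-evens-interleave : ∀ xs ys → length xs ≡ length ys →
    (odds (interleave xs ys) ≡ xs) × (evens (interleave xs ys) ≡ ys)
  odds-evens-interleave [] [] _ = refl , refl
  odds-evens-interleave (x ∷ xs) (y ∷ ys) eq =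
    let (o , e) = odds-evens-interleave xs ys (suc-injective eq) in cong (x ∷_) o , cong (y ∷_) e

  bit : Bool → ℕ
  bit true = 1
  bit false = 0

  prefix : ∀ {n} → ℕ → Subset n → ℕ
  prefix zero _ = 0
  prefix (suc v) [] = 0
  prefix (suc v) (b ∷ I) = bit b + prefix v I

  prefix≡below : ∀ {n} v (I : Subset n) → prefix v I ≡ below v (elems I)
  prefix≡below zero I = sym (below-zero (elems I))
  prefix≡below (suc v) [] = refl
  prefix≡below (suc v) (true ∷ I) with 0 <? suc v
  ... | yes _ = cong suc (trans (prefix≡below v I) (sym (below-suc v (elems I))))
  ... | no 0≮1+v = ⊥-elim (0≮1+v (s≤s z≤n))
  prefix≡below (suc v) (false ∷ I) = trans (prefix≡below v I) (sym (below-suc v (elems I)))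

  ascending-suc : ∀ xs → Ascending xs → Ascending (map suc xs)
  ascending-suc xs xs↑ = AllPairsₚ.map⁺ (AllPairs.map s≤s xs↑)

  ascending-0∷suc : ∀ xs → Ascending xs → Ascending (0 ∷ map suc xs)
  ascending-0∷suc xs xs↑ = All.tabulate (λ _ → z≤n) ∷ ascending-suc xs xs↑

  elems-ascending : ∀ {n} (I : Subset n) → Ascending (elems I)
  elems-ascending [] = []
  elems-ascending (true ∷ I) = ascending-0∷suc _ (elems-ascending I)
  elems-ascending (false ∷ I) = ascending-suc _ (elems-ascending I)

  length-elems : ∀ {n} (I : Subset n) → length (elems I) ≡ ∣ I ∣
  length-elems [] = refl
  length-elems (true ∷ I) = cong suc (trans (length-map suc (elems I)) (length-elems I))
  length-elems (false ∷ I) = trans (length-map suc (elems I)) (length-elems I)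

  Balanced : ∀ {n} → Subset n → Subset n → Set
  Balanced I J = ∀ v → (prefix v J ≤ prefix v I) × (prefix v I ≤ suc (prefix v J))

  balanced-refl : ∀ {n} (I : Subset n) → Balanced I I
  balanced-refl I v = ≤-refl , n≤1+n _

  -- the odd and even positions of a merged list alternate
  sorted⇒balanced : ∀ {n} (I J : Subset n) → SortedPair I J → Balanced I J
  sorted⇒balanced I J (I≡U , J≡V) v =
    subst₂ (λ p q → (q ≤ p) × (p ≤ suc q))
      (sym (trans (prefix≡below v I) (cong (below v) I≡U)))
      (sym (trans (prefix≡below v J) (cong (below v) J≡V)))
      (odds-evens-below v _ (merge-ascending _ _ (elems-ascending I) (elems-ascending J)))

  balanced⇒interleave-ascending : ∀ {n} (I J : Subset n) → Balanced I J →
    Ascending (interleave (elems I) (elems J))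
  balanced⇒interleave-ascending [] [] _ = []
  balanced⇒interleave-ascending (false ∷ I) (false ∷ J) bal
    rewrite interleave-suc (elems I) (elems J) =
    ascending-suc _ (balanced⇒interleave-ascending I J (λ v → bal (suc v)))
  balanced⇒interleave-ascending (true ∷ I) (true ∷ J) bal
    rewrite interleave-suc (elems I) (elems J) =
    All.tabulate (λ _ → z≤n) ∷ ascending-0∷suc _ (balanced⇒interleave-ascending I J
      (λ v → let (J≤I , I≤1+J) = bal (suc v) in ≤-pred J≤I , ≤-pred I≤1+J))
  balanced⇒interleave-ascending (true ∷ I) (false ∷ J) bal
    rewrite interleave-∷ 0 (map suc (elems I)) (map suc (elems J))
          | interleave-suc (elems J) (elems I) =
    ascending-0∷suc _ (balanced⇒interleave-ascending J I
      (λ v → let (J≤I , I≤1+J) = bal (suc v) in ≤-pred I≤1+J , J≤I))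
  balanced⇒interleave-ascending (false ∷ I) (true ∷ J) bal with bal 1
  ... | () , _

  -- conversely, for balanced I and J of equal size the merge is the
  -- alternating list, whose odd and even positions are I and J
  balanced⇒sorted : ∀ {n} (I J : Subset n) → ∣ I ∣ ≡ ∣ J ∣ → Balanced I J → SortedPair I J
  balanced⇒sorted I J |I|≡|J| bal =
    subst (λ m → (elems I ≡ odds m) × (elems J ≡ evens m)) (sym merge≡interleave)
      (sym (proj₁ odds-evens) , sym (proj₂ odds-evens))
    where
    merge≡interleave : merge (elems I) (elems J) ≡ interleave (elems I) (elems J)
    merge≡interleave =
      ascending-ext _ _ (merge-ascending _ _ (elems-ascending I) (elems-ascending J))
        (balanced⇒interleave-ascending I J bal)
        (λ v → trans (below-merge v (elems I) (elems J)) (sym (below-interleave v (elems I) (elems J))))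
    odds-evens : (odds (interleave (elems I) (elems J)) ≡ elems I) × (evens (interleave (elems I) (elems J)) ≡ elems J)
    odds-evens = odds-evens-interleave (elems I) (elems J)
      (trans (length-elems I) (trans |I|≡|J| (sym (length-elems J))))

open SortedPairs

-- Balanced lists are determined by their column counts.
--
-- For each v, the prefix counts of the members of L then
-- form a weakly decreasing list dropping by at most one in total, which
-- is determined by its length and its sum; and the sums over v are
-- determined by how many members of L contain each i ∈ [n].
module BalancedLists where

  open import Data.Nat using (ℕ; zero; suc; _≤_; _<_; z≤n; s≤s; _+_)
  open import Data.Nat.Properties
  open import Data.Nat.ListAction using (sum)
  open import Data.Fin using (zero; suc)
  open import Data.List.Properties using (∷-injectiveˡ; ∷-injectiveʳ)
  open import Algebra.Properties.CommutativeSemigroup +-commutativeSemigroup using (interchange)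

  BalancedList : ∀ {n} → List (Subset n) → Set
  BalancedList = AllPairs Balanced

  AlmostConstant : List ℕ → Set
  AlmostConstant = AllPairs (λ a b → (b ≤ a) × (a ≤ suc b))

  sum-separated : ∀ a xs ys → All (_≤ a) xs → All (a ≤_) ys → length xs ≡ length ys →
    sum xs ≤ sum ys
  sum-separated a [] [] _ _ _ = z≤n
  sum-separated a (x ∷ xs) (y ∷ ys) (x≤a ∷ xs≤a) (a≤y ∷ a≤ys) eq =
    +-mono-≤ (≤-trans x≤a a≤y) (sum-separated a xs ys xs≤a a≤ys (suc-injective eq))

  smaller-head-smaller-sum : ∀ {x y xs ys} → x < y →
    All (λ b → (b ≤ x) × (x ≤ suc b)) xs → All (λ b → (b ≤ y) × (y ≤ suc b)) ys →
    length xs ≡ length ys → x + sum xs < y + sum ys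
  smaller-head-smaller-sum {x} {xs = xs} {ys} x<y x~xs y~ys len =
    +-mono-<-≤ x<y (sum-separated x xs ys (All.map proj₁ x~xs)
      (All.map (λ y~b → ≤-pred (≤-trans x<y (proj₂ y~b))) y~ys) len)

  almost-constant-unique : ∀ xs ys → AlmostConstant xs → AlmostConstant ys →
    length xs ≡ length ys → sum xs ≡ sum ys → xs ≡ ys
  almost-constant-unique [] [] _ _ _ _ = refl
  almost-constant-unique (x ∷ xs) (y ∷ ys) (x~xs ∷ xs~) (y~ys ∷ ys~) len eq with <-cmp x y
  ... | tri< x<y _ _ =
    ⊥-elim (<⇒≢ (smaller-head-smaller-sum x<y x~xs y~ys (suc-injective len)) eq)
  ... | tri> _ _ y<x =
    ⊥-elim (<⇒≢ (smaller-head-smaller-sum y<x y~ys x~xs (sym (suc-injective len))) (sym eq))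
  ... | tri≈ _ refl _ =
    cong (x ∷_) (almost-constant-unique xs ys xs~ ys~ (suc-injective len) (+-cancelˡ-≡ x _ _ eq))

  bit-injective : ∀ a b → bit a ≡ bit b → a ≡ b
  bit-injective true true _ = refl
  bit-injective false false _ = refl
  bit-injective true false ()
  bit-injective false true ()

  prefix-ext : ∀ {n} (I J : Subset n) → (∀ v → prefix v I ≡ prefix v J) → I ≡ J
  prefix-ext [] [] _ = refl
  prefix-ext (a ∷ I) (b ∷ J) same = cong₂ _∷_ a≡b (prefix-ext I J λ v →
    +-cancelˡ-≡ (bit a) _ _ (trans (same (suc v)) (cong (λ c → bit c + prefix v J) (sym a≡b))))
    where
    a≡b : a ≡ b
    a≡b = bit-injective a b (trans (sym (+-identityʳ (bit a))) (trans (same 1) (+-identityʳ (bit b))))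

  prefixes-almost-constant : ∀ {n} v (L : List (Subset n)) → BalancedList L →
    AlmostConstant (map (prefix v) L)
  prefixes-almost-constant v L bal = AllPairsₚ.map⁺ (AllPairs.map (λ b → b v) bal)

  prefixTotal : ∀ {n} → ℕ → List (Subset n) → ℕ
  prefixTotal v L = sum (map (prefix v) L)

  column : ∀ {n} → List (Subset n) → Fin n → ℕ
  column L i = sum (map (λ S → bit (lookup S i)) L)

  column≤length : ∀ {n} (L : List (Subset n)) i → column L i ≤ length L
  column≤length [] i = z≤n
  column≤length (S ∷ L) i = +-mono-≤ (bit≤1 (lookup S i)) (column≤length L i)
    where
    bit≤1 : ∀ b → bit b ≤ 1
    bit≤1 true = s≤s z≤n
    bit≤1 false = z≤n

  balanced-unique-by-prefixes : ∀ {n} (L₁ L₂ : List (Subset n)) →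
    BalancedList L₁ → BalancedList L₂ → length L₁ ≡ length L₂ →
    (∀ v → prefixTotal v L₁ ≡ prefixTotal v L₂) → L₁ ≡ L₂
  balanced-unique-by-prefixes L₁ L₂ bal₁ bal₂ len totals = pointwise L₁ L₂ same-prefixes len
    where
    same-prefixes : ∀ v → map (prefix v) L₁ ≡ map (prefix v) L₂
    same-prefixes v = almost-constant-unique _ _
      (prefixes-almost-constant v L₁ bal₁) (prefixes-almost-constant v L₂ bal₂)
      (trans (length-map (prefix v) L₁) (trans len (sym (length-map (prefix v) L₂)))) (totals v)
    pointwise : ∀ (L₁ L₂ : List (Subset _)) → (∀ v → map (prefix v) L₁ ≡ map (prefix v) L₂) →
      length L₁ ≡ length L₂ → L₁ ≡ L₂
    pointwise [] [] _ _ = refl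
    pointwise (I ∷ L₁) (J ∷ L₂) same len = cong₂ _∷_
      (prefix-ext I J (λ v → ∷-injectiveˡ (same v)))
      (pointwise L₁ L₂ (λ v → ∷-injectiveʳ (same v)) (suc-injective len))

  prefixTotal-suc : ∀ {n} v (L : List (Subset (suc n))) →
    prefixTotal (suc v) L ≡ column L zero + prefixTotal v (map Vec.tail L)
  prefixTotal-suc v [] = refl
  prefixTotal-suc v ((b ∷ S) ∷ L) =
    trans (cong (bit b + prefix v S +_) (prefixTotal-suc v L)) (interchange (bit b) _ _ _)

  column-suc : ∀ {n} (L : List (Subset (suc n))) i →
    column L (suc i) ≡ column (map Vec.tail L) i
  column-suc [] i = refl
  column-suc ((b ∷ S) ∷ L) i = cong (bit (lookup S i) +_) (column-suc L i)

  prefixTotal-zero : ∀ {n} (L : List (Subset n)) → prefixTotal 0 L ≡ 0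
  prefixTotal-zero [] = refl
  prefixTotal-zero (_ ∷ L) = prefixTotal-zero L

  prefixTotal-empty : ∀ v (L : List (Subset 0)) → prefixTotal v L ≡ 0
  prefixTotal-empty zero L = prefixTotal-zero L
  prefixTotal-empty (suc v) [] = refl
  prefixTotal-empty (suc v) ([] ∷ L) = prefixTotal-empty (suc v) L

  columns⇒prefixTotals : ∀ {n} (L₁ L₂ : List (Subset n)) →
    (∀ i → column L₁ i ≡ column L₂ i) → ∀ v → prefixTotal v L₁ ≡ prefixTotal v L₂
  columns⇒prefixTotals {zero} L₁ L₂ _ v = trans (prefixTotal-empty v L₁) (sym (prefixTotal-empty v L₂))
  columns⇒prefixTotals {suc n} L₁ L₂ _ zero = trans (prefixTotal-zero L₁) (sym (prefixTotal-zero L₂))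
  columns⇒prefixTotals {suc n} L₁ L₂ same (suc v) = begin
    prefixTotal (suc v) L₁ ≡⟨ prefixTotal-suc v L₁ ⟩
    column L₁ zero + prefixTotal v (map Vec.tail L₁)
      ≡⟨ cong₂ _+_ (same zero) (columns⇒prefixTotals (map Vec.tail L₁) (map Vec.tail L₂) same-tails v) ⟩
    column L₂ zero + prefixTotal v (map Vec.tail L₂) ≡⟨ prefixTotal-suc v L₂ ⟨
    prefixTotal (suc v) L₂ ∎
    where
    open ≡-Reasoning
    same-tails : ∀ i → column (map Vec.tail L₁) i ≡ column (map Vec.tail L₂) i
    same-tails i = trans (sym (column-suc L₁ i)) (trans (same (suc i)) (column-suc L₂ i))

  prefixTotals⇒columns : ∀ {n} (L₁ L₂ : List (Subset n)) →
    (∀ v → prefixTotal v L₁ ≡ prefixTotal v L₂) → ∀ i → column L₁ i ≡ column L₂ i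
  prefixTotals⇒columns {suc n} L₁ L₂ same i = go i
    where
    open ≡-Reasoning
    tails₁ tails₂ : List (Subset n)
    tails₁ = map Vec.tail L₁
    tails₂ = map Vec.tail L₂
    first : column L₁ zero ≡ column L₂ zero
    first = +-cancelʳ-≡ 0 _ _ (begin
      column L₁ zero + 0 ≡⟨ cong (column L₁ zero +_) (prefixTotal-zero tails₁) ⟨
      column L₁ zero + prefixTotal 0 tails₁ ≡⟨ prefixTotal-suc 0 L₁ ⟨
      prefixTotal 1 L₁ ≡⟨ same 1 ⟩
      prefixTotal 1 L₂ ≡⟨ prefixTotal-suc 0 L₂ ⟩
      column L₂ zero + prefixTotal 0 tails₂ ≡⟨ cong (column L₂ zero +_) (prefixTotal-zero tails₂) ⟩
      column L₂ zero + 0 ∎)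
    same-tails : ∀ v → prefixTotal v tails₁ ≡ prefixTotal v tails₂
    same-tails v = +-cancelˡ-≡ (column L₁ zero) _ _ (begin
      column L₁ zero + prefixTotal v tails₁ ≡⟨ prefixTotal-suc v L₁ ⟨
      prefixTotal (suc v) L₁ ≡⟨ same (suc v) ⟩
      prefixTotal (suc v) L₂ ≡⟨ prefixTotal-suc v L₂ ⟩
      column L₂ zero + prefixTotal v tails₂ ≡⟨ cong (_+ prefixTotal v tails₂) first ⟨
      column L₁ zero + prefixTotal v tails₂ ∎)
    go : ∀ i → column L₁ i ≡ column L₂ i
    go zero = first
    go (suc i) = trans (column-suc L₁ i)
      (trans (prefixTotals⇒columns tails₁ tails₂ same-tails i) (sym (column-suc L₂ i)))

  balanced-unique : ∀ {n} (L₁ L₂ : List (Subset n)) →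
    BalancedList L₁ → BalancedList L₂ → length L₁ ≡ length L₂ →
    (∀ i → column L₁ i ≡ column L₂ i) → L₁ ≡ L₂
  balanced-unique L₁ L₂ bal₁ bal₂ len same =
    balanced-unique-by-prefixes L₁ L₂ bal₁ bal₂ len (columns⇒prefixTotals L₁ L₂ same)

open BalancedLists

-- Clearing denominators.
--
-- A list of nonnegative rationals  ls  is written as  ms / N  with
-- natural numerators  ms  and a common positive denominator N; convex
-- combinations of characteristic vectors then become integer counts.
module ClearingDenominators where

  open import Data.Nat as ℕ using (ℕ; suc)
  import Data.Nat.Properties as ℕₚ
  open import Data.Nat.ListAction using (sum)
  open import Data.Integer as ℤ using (+_; -[1+_])
  import Data.Integer.Properties as ℤₚ
  open import Data.Rational
  open import Data.Rational.Properties
  open import Data.Rational.Literals using (fromℤ)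
  import Data.Rational.Unnormalised as ℚᵘ
  import Data.Rational.Unnormalised.Properties as ℚᵘₚ
  open import Data.List using (zipWith)
  open import Data.List.Relation.Binary.Pointwise using (Pointwise; []; _∷_)
  open ≡-Reasoning

  ι : ℕ → ℚ
  ι n = fromℤ (+ n)

  ι-+ : ∀ a b → ι (a ℕ.+ b) ≡ ι a + ι b
  ι-+ a b = toℚᵘ-injective (ℚᵘₚ.≃-sym (ℚᵘₚ.≃-trans (toℚᵘ-homo-+ (ι a) (ι b)) (ℚᵘ.*≡* eq)))
    where
    eq : (+ a ℤ.* + 1 ℤ.+ + b ℤ.* + 1) ℤ.* + 1 ≡ + (a ℕ.+ b) ℤ.* (+ 1 ℤ.* + 1)
    eq = trans (ℤₚ.*-identityʳ _)
      (trans (cong₂ ℤ._+_ (ℤₚ.*-identityʳ (+ a)) (ℤₚ.*-identityʳ (+ b)))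
        (sym (trans (ℤₚ.*-identityʳ _) (ℤₚ.pos-+ a b))))

  ι-* : ∀ a b → ι (a ℕ.* b) ≡ ι a * ι b
  ι-* a b = toℚᵘ-injective (ℚᵘₚ.≃-sym (ℚᵘₚ.≃-trans (toℚᵘ-homo-* (ι a) (ι b)) (ℚᵘ.*≡* eq)))
    where
    eq : (+ a ℤ.* + b) ℤ.* + 1 ≡ + (a ℕ.* b) ℤ.* (+ 1 ℤ.* + 1)
    eq = trans (ℤₚ.*-identityʳ _) (sym (trans (ℤₚ.*-identityʳ _) (ℤₚ.pos-* a b)))

  ι-injective : ∀ {a b} → ι a ≡ ι b → a ≡ b
  ι-injective eq = ℤₚ.+-injective (cong ↥_ eq)

  ι-cancelʳ : ∀ a b N' → a * ι (suc N') ≡ b * ι (suc N') → a ≡ b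
  ι-cancelʳ a b N' eq = begin
    a                              ≡⟨ *-identityʳ a ⟨
    a * 1ℚ                         ≡⟨ cong (a *_) (*-inverseʳ N) ⟨
    a * (N * 1/ N)                 ≡⟨ *-assoc a N (1/ N) ⟨
    (a * N) * 1/ N                 ≡⟨ cong (_* 1/ N) eq ⟩
    (b * N) * 1/ N                 ≡⟨ *-assoc b N (1/ N) ⟩
    b * (N * 1/ N)                 ≡⟨ cong (b *_) (*-inverseʳ N) ⟩
    b * 1ℚ                         ≡⟨ *-identityʳ b ⟩
    b ∎
    where
    N : ℚ
    N = ι (suc N')

  Scaled : ℕ → List ℚ → List ℕ → Set
  Scaled N = Pointwise (λ l m → l * ι N ≡ ι m)

  times-denominator : ∀ q → 0ℚ ≤ q → q * ι (↧ₙ q) ≡ ι (ℤ.∣ ↥ q ∣)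
  times-denominator q@(mkℚ (+ p) d-1 _) _ =
    toℚᵘ-injective (ℚᵘₚ.≃-trans (toℚᵘ-homo-* q (ι (suc d-1))) (ℚᵘ.*≡* eq))
    where
    eq : (+ p ℤ.* + suc d-1) ℤ.* + 1 ≡ + p ℤ.* (+ suc d-1 ℤ.* + 1)
    eq = trans (ℤₚ.*-identityʳ _) (cong (+ p ℤ.*_) (sym (ℤₚ.*-identityʳ _)))
  times-denominator (mkℚ -[1+ _ ] _ _) (*≤* ())

  rescale : ∀ {N} d ls ms → Scaled N ls ms → Scaled (d ℕ.* N) ls (map (ℕ._* d) ms)
  rescale d [] [] [] = []
  rescale {N} d (l ∷ ls) (m ∷ ms) (l·N≡m ∷ rest) = step ∷ rescale d ls ms rest
    where
    step : l * ι (d ℕ.* N) ≡ ι (m ℕ.* d)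
    step = begin
      l * ι (d ℕ.* N)   ≡⟨ cong (l *_) (trans (cong ι (ℕₚ.*-comm d N)) (ι-* N d)) ⟩
      l * (ι N * ι d)   ≡⟨ *-assoc l (ι N) (ι d) ⟨
      (l * ι N) * ι d   ≡⟨ cong (_* ι d) l·N≡m ⟩
      ι m * ι d         ≡⟨ ι-* m d ⟨
      ι (m ℕ.* d) ∎

  -- nonnegative rationals over the product of their denominators
  common-denominator : ∀ ls → All (0ℚ ≤_) ls →
    Σ ℕ λ N' → Σ (List ℕ) λ ms → Scaled (suc N') ls ms
  common-denominator [] [] = 0 , [] , []
  common-denominator (l@(mkℚ num d-1 _) ∷ ls) (0≤l ∷ 0≤ls)
    with common-denominator ls 0≤ls
  ... | N' , ms , scaled =
    N' ℕ.+ d-1 ℕ.* suc N' ,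
    ℤ.∣ num ∣ ℕ.* suc N' ∷ map (ℕ._* suc d-1) ms ,
    head ∷ rescale (suc d-1) ls ms scaled
    where
    head : l * ι (suc d-1 ℕ.* suc N') ≡ ι (ℤ.∣ num ∣ ℕ.* suc N')
    head = begin
      l * ι (suc d-1 ℕ.* suc N')          ≡⟨ cong (l *_) (ι-* (suc d-1) (suc N')) ⟩
      l * (ι (suc d-1) * ι (suc N'))      ≡⟨ *-assoc l (ι (suc d-1)) (ι (suc N')) ⟨
      (l * ι (suc d-1)) * ι (suc N')      ≡⟨ cong (_* ι (suc N')) (times-denominator l 0≤l) ⟩
      ι ℤ.∣ num ∣ * ι (suc N')            ≡⟨ ι-* ℤ.∣ num ∣ (suc N') ⟨
      ι (ℤ.∣ num ∣ ℕ.* suc N') ∎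

  common-denominator₂ : ∀ ls ls' → All (0ℚ ≤_) ls → All (0ℚ ≤_) ls' →
    Σ ℕ λ N' → Σ (List ℕ) λ ms → Σ (List ℕ) λ ms' →
    Scaled (suc N') ls ms × Scaled (suc N') ls' ms'
  common-denominator₂ ls ls' 0≤ls 0≤ls'
    with common-denominator ls 0≤ls | common-denominator ls' 0≤ls'
  ... | N₁ , ms₁ , scaled₁ | N₂ , ms₂ , scaled₂ =
    N₁ ℕ.+ N₂ ℕ.* suc N₁ , map (ℕ._* suc N₂) ms₁ , map (ℕ._* suc N₁) ms₂ ,
    rescale (suc N₂) ls ms₁ scaled₁ ,
    subst (λ N → Scaled N ls' (map (ℕ._* suc N₁) ms₂)) (ℕₚ.*-comm (suc N₁) (suc N₂))
      (rescale (suc N₁) ls' ms₂ scaled₂)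

  divideBy : ℕ → List ℕ → List ℚ
  divideBy N' = map (λ w → ι w * 1/ ι (suc N'))

  divideBy-scaled : ∀ N' ws → Scaled (suc N') (divideBy N' ws) ws
  divideBy-scaled N' [] = []
  divideBy-scaled N' (w ∷ ws) = quotient·N ∷ divideBy-scaled N' ws
    where
    quotient·N : ι w * 1/ ι (suc N') * ι (suc N') ≡ ι w
    quotient·N = trans (*-assoc (ι w) (1/ ι (suc N')) (ι (suc N')))
      (trans (cong (ι w *_) (*-inverseˡ (ι (suc N')))) (*-identityʳ (ι w)))

  divideBy-nonneg : ∀ N' ws → All (0ℚ ≤_) (divideBy N' ws)
  divideBy-nonneg N' ws = All.map nonneg (scaled⇒All (divideBy-scaled N' ws))
    where
    scaled⇒All : ∀ {ls ms} → Scaled (suc N') ls ms → All (λ l → Σ ℕ λ m → l * ι (suc N') ≡ ι m) ls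
    scaled⇒All [] = []
    scaled⇒All {ms = m ∷ _} (eq ∷ rest) = (m , eq) ∷ scaled⇒All rest
    nonneg : ∀ {l} → (Σ ℕ λ m → l * ι (suc N') ≡ ι m) → 0ℚ ≤ l
    nonneg {l} (m , eq) = *-cancelʳ-≤-pos (ι (suc N'))
      (subst₂ _≤_ (sym (*-zeroˡ (ι (suc N')))) (sym eq) (nonNegative⁻¹ (ι m)))

  weightedColumn : ∀ {n} → List ℕ → List (Subset n) → Fin n → ℕ
  weightedColumn ms C i = sum (zipWith (λ m S → m ℕ.* bit (lookup S i)) ms C)

  ε≡ι-bit : ∀ {n} (S : Subset n) i → ε S i ≡ ι (bit (lookup S i))
  ε≡ι-bit S i with lookup S i
  ... | true = refl
  ... | false = refl

  sum-scaled : ∀ N ls ms → Scaled N ls ms → sumℚ ls * ι N ≡ ι (sum ms)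
  sum-scaled N [] [] [] = *-zeroˡ (ι N)
  sum-scaled N (l ∷ ls) (m ∷ ms) (l·N≡m ∷ rest) =
    trans (*-distribʳ-+ (ι N) l (sumℚ ls))
      (trans (cong₂ _+_ l·N≡m (sum-scaled N ls ms rest)) (sym (ι-+ m (sum ms))))

  lincomb-scaled : ∀ {n} N ls ms (C : List (Subset n)) i → Scaled N ls ms →
    lincomb ls (map ε C) i * ι N ≡ ι (weightedColumn ms C i)
  lincomb-scaled N [] [] C i [] = *-zeroˡ (ι N)
  lincomb-scaled N (l ∷ ls) (m ∷ ms) [] i (_ ∷ _) = *-zeroˡ (ι N)
  lincomb-scaled N (l ∷ ls) (m ∷ ms) (S ∷ C) i (l·N≡m ∷ rest) = begin
    (l * ε S i + lincomb ls (map ε C) i) * ι N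
      ≡⟨ *-distribʳ-+ (ι N) (l * ε S i) (lincomb ls (map ε C) i) ⟩
    (l * ε S i) * ι N + lincomb ls (map ε C) i * ι N
      ≡⟨ cong₂ _+_ first (lincomb-scaled N ls ms C i rest) ⟩
    ι (m ℕ.* bit (lookup S i)) + ι (weightedColumn ms C i)
      ≡⟨ ι-+ (m ℕ.* bit (lookup S i)) (weightedColumn ms C i) ⟨
    ι (m ℕ.* bit (lookup S i) ℕ.+ weightedColumn ms C i) ∎
    where
    first : (l * ε S i) * ι N ≡ ι (m ℕ.* bit (lookup S i))
    first = begin
      (l * ε S i) * ι N     ≡⟨ *-assoc l (ε S i) (ι N) ⟩
      l * (ε S i * ι N)     ≡⟨ cong (l *_) (*-comm (ε S i) (ι N)) ⟩
      l * (ι N * ε S i)     ≡⟨ *-assoc l (ι N) (ε S i) ⟨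
      (l * ι N) * ε S i     ≡⟨ cong₂ _*_ l·N≡m (ε≡ι-bit S i) ⟩
      ι m * ι (bit (lookup S i)) ≡⟨ ι-* m (bit (lookup S i)) ⟨
      ι (m ℕ.* bit (lookup S i)) ∎

open ClearingDenominators

-- Supports of nonnegative representations.
--
-- A weighted collection (ls , C) represents the point Σ lᵢ ε_{Cᵢ}.  With a
-- common denominator N, the weights become multiplicities and (ls , C)
-- becomes a list of N·Σls subsets (its expansion) whose column counts
-- are N times the coordinates of the point.  Expansions of balanced
-- collections are balanced, hence determined by the point (previous
-- section): two nonnegative representations of the same point by
-- balanced collections have the same support.
module Supports where

  open import Data.Nat as ℕ using (ℕ; zero; suc)
  import Data.Nat.Properties as ℕₚ
  open import Data.Nat.ListAction using (sum)
  open import Data.Rational using (ℚ; 0ℚ; _≤_; _*_)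
  open import Data.Rational.Properties using (*-zeroˡ)
  open import Data.List using (replicate; _++_)
  open import Data.List.Properties using (length-++; length-replicate)
  import Data.List.Relation.Unary.All.Properties as Allₚ
  open import Data.List.Relation.Binary.Pointwise using (Pointwise; []; _∷_; Pointwise-length)
  open import Data.List.Membership.Propositional using (_∈_)
  open import Data.List.Relation.Unary.Any using (here; there)
  open import Data.List.Membership.Propositional.Properties using (∈-++⁺ʳ; ∈-++⁻)
  open import Data.Sum using (_⊎_; inj₁; inj₂)

  Carries : ∀ {n} {W : Set} → W → List W → List (Subset n) → Subset n → Set
  Carries z (w ∷ ws) (S ∷ C) T = (w ≢ z × S ≡ T) ⊎ Carries z ws C T
  Carries z _ _ _ = ⊥

  carries⇒∈ : ∀ {n} {W : Set} {z : W} ws (C : List (Subset n)) {T} → Carries z ws C T → T ∈ C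
  carries⇒∈ (w ∷ ws) (S ∷ C) (inj₁ (_ , refl)) = here refl
  carries⇒∈ (w ∷ ws) (S ∷ C) (inj₂ rest) = there (carries⇒∈ ws C rest)

  carries-transfer : ∀ {n} {W W' : Set} {z : W} {z' : W'} {ws ws'} (C : List (Subset n)) {T} →
    Pointwise (λ w w' → w ≢ z → w' ≢ z') ws ws' → Carries z ws C T → Carries z' ws' C T
  carries-transfer (S ∷ C) (w⇒w' ∷ _) (inj₁ (w≢z , S≡T)) = inj₁ (w⇒w' w≢z , S≡T)
  carries-transfer (S ∷ C) (_ ∷ rest) (inj₂ carried) = inj₂ (carries-transfer C rest carried)

  scaled-nonzero : ∀ {N' ls ms} → Scaled (suc N') ls ms → Pointwise (λ l m → l ≢ 0ℚ → m ≢ 0) ls ms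
  scaled-nonzero [] = []
  scaled-nonzero {N'} {l ∷ _} (l·N≡m ∷ rest) =
    (λ { l≢0 refl → l≢0 (ι-cancelʳ l 0ℚ N' (trans l·N≡m (sym (*-zeroˡ (ι (suc N')))))) })
    ∷ scaled-nonzero rest

  scaled-nonzero⁻ : ∀ {N' ls ms} → Scaled (suc N') ls ms → Pointwise (λ m l → m ≢ 0 → l ≢ 0ℚ) ms ls
  scaled-nonzero⁻ [] = []
  scaled-nonzero⁻ {N'} (l·N≡m ∷ rest) =
    (λ { m≢0 refl → m≢0 (ι-injective (trans (sym l·N≡m) (*-zeroˡ (ι (suc N'))))) })
    ∷ scaled-nonzero⁻ rest

  expand : ∀ {n} → List ℕ → List (Subset n) → List (Subset n)
  expand (m ∷ ms) (S ∷ C) = replicate m S ++ expand ms C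
  expand _ _ = []

  column-++ : ∀ {n} (xs ys : List (Subset n)) i → column (xs ++ ys) i ≡ column xs i ℕ.+ column ys i
  column-++ [] ys i = refl
  column-++ (x ∷ xs) ys i =
    trans (cong (bit (lookup x i) ℕ.+_) (column-++ xs ys i)) (sym (ℕₚ.+-assoc (bit (lookup x i)) _ _))

  column-replicate : ∀ {n} m (S : Subset n) i → column (replicate m S) i ≡ m ℕ.* bit (lookup S i)
  column-replicate zero S i = refl
  column-replicate (suc m) S i = cong (bit (lookup S i) ℕ.+_) (column-replicate m S i)

  column-expand : ∀ {n} ms (C : List (Subset n)) i → column (expand ms C) i ≡ weightedColumn ms C i
  column-expand [] C i = refl
  column-expand (m ∷ ms) [] i = refl
  column-expand (m ∷ ms) (S ∷ C) i = trans (column-++ (replicate m S) (expand ms C) i)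
    (cong₂ ℕ._+_ (column-replicate m S i) (column-expand ms C i))

  length-expand : ∀ {n} ms (C : List (Subset n)) → length ms ≡ length C → length (expand ms C) ≡ sum ms
  length-expand [] [] _ = refl
  length-expand (m ∷ ms) (S ∷ C) len = trans (length-++ (replicate m S))
    (cong₂ ℕ._+_ (length-replicate m) (length-expand ms C (ℕₚ.suc-injective len)))

  All-expand : ∀ {n} {P : Subset n → Set} ms C → All P C → All P (expand ms C)
  All-expand [] C _ = []
  All-expand (m ∷ ms) [] _ = []
  All-expand (m ∷ ms) (S ∷ C) (pS ∷ pC) = Allₚ.++⁺ (Allₚ.replicate⁺ m pS) (All-expand ms C pC)

  AllPairs-replicate : ∀ {A : Set} {R : A → A → Set} m {x} → R x x → AllPairs R (replicate m x)
  AllPairs-replicate zero _ = []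
  AllPairs-replicate (suc m) Rxx = Allₚ.replicate⁺ m Rxx ∷ AllPairs-replicate m Rxx

  expand-balanced : ∀ {n} ms (C : List (Subset n)) → BalancedList C → BalancedList (expand ms C)
  expand-balanced [] C _ = []
  expand-balanced (m ∷ ms) [] _ = []
  expand-balanced (m ∷ ms) (S ∷ C) (S~C ∷ bal) = AllPairsₚ.++⁺
    (AllPairs-replicate m (balanced-refl S)) (expand-balanced ms C bal)
    (Allₚ.replicate⁺ m (All-expand ms C S~C))

  ∈-expand⁺ : ∀ {n} ms (C : List (Subset n)) {T} → Carries 0 ms C T → T ∈ expand ms C
  ∈-expand⁺ (zero ∷ ms) (S ∷ C) (inj₁ (0≢0 , _)) = ⊥-elim (0≢0 refl)
  ∈-expand⁺ (suc m ∷ ms) (S ∷ C) (inj₁ (_ , refl)) = here refl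
  ∈-expand⁺ (m ∷ ms) (S ∷ C) (inj₂ carried) = ∈-++⁺ʳ (replicate m S) (∈-expand⁺ ms C carried)

  ∈-expand⁻ : ∀ {n} ms (C : List (Subset n)) {T} → T ∈ expand ms C → Carries 0 ms C T
  ∈-expand⁻ (m ∷ ms) (S ∷ C) T∈ with ∈-++⁻ (replicate m S) T∈
  ... | inj₁ T∈copies = inj₁ (copies-nonempty m T∈copies , sym (∈-replicate m T∈copies))
    where
    ∈-replicate : ∀ m {T} → T ∈ replicate m S → T ≡ S
    ∈-replicate (suc m) (here T≡S) = T≡S
    ∈-replicate (suc m) (there T∈) = ∈-replicate m T∈
    copies-nonempty : ∀ m {T} → T ∈ replicate m S → m ≢ 0
    copies-nonempty (suc m) _ ()
  ... | inj₂ T∈rest = inj₂ (∈-expand⁻ ms C T∈rest)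

  support-⊆ : ∀ {n} (C C' : List (Subset n)) (ls ls' : List ℚ) →
    BalancedList C → BalancedList C' → length ls ≡ length C → length ls' ≡ length C' →
    All (0ℚ ≤_) ls → All (0ℚ ≤_) ls' → sumℚ ls ≡ sumℚ ls' →
    (∀ i → lincomb ls (map ε C) i ≡ lincomb ls' (map ε C') i) →
    ∀ T → Carries 0ℚ ls C T → Carries 0ℚ ls' C' T
  support-⊆ C C' ls ls' bal bal' len len' 0≤ls 0≤ls' same-sum same-point T carried
    with common-denominator₂ ls ls' 0≤ls 0≤ls'
  ... | N' , ms , ms' , scaled , scaled' =
    carries-transfer C' (scaled-nonzero⁻ scaled')
      (∈-expand⁻ ms' C' (subst (T ∈_) same-expansion
        (∈-expand⁺ ms C (carries-transfer C (scaled-nonzero scaled) carried))))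
    where
    N : ℕ
    N = suc N'
    lenms : length ms ≡ length C
    lenms = trans (sym (Pointwise-length scaled)) len
    lenms' : length ms' ≡ length C'
    lenms' = trans (sym (Pointwise-length scaled')) len'
    same-total : sum ms ≡ sum ms'
    same-total = ι-injective (trans (sym (sum-scaled N ls ms scaled))
      (trans (cong (_* ι N) same-sum) (sum-scaled N ls' ms' scaled')))
    same-columns : ∀ i → column (expand ms C) i ≡ column (expand ms' C') i
    same-columns i = trans (column-expand ms C i) (trans (ι-injective (trans
      (sym (lincomb-scaled N ls ms C i scaled))
      (trans (cong (_* ι N) (same-point i)) (lincomb-scaled N ls' ms' C' i scaled'))))
      (sym (column-expand ms' C' i)))
    same-expansion : expand ms C ≡ expand ms' C'
    same-expansion = balanced-unique _ _ (expand-balanced ms C bal) (expand-balanced ms' C' bal')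
      (trans (length-expand ms C lenms) (trans same-total (sym (length-expand ms' C' lenms'))))
      same-columns

open Supports

-- The simplices σ_C of balanced collections form a simplicial complex.
--
-- Two such simplices meet in a common face: a point of both is a convex
-- combination of the members of C that it carries, and these are also
-- carried by C'.  Affine independence: an affine dependence Σ lᵢ ε_{Cᵢ} = 0,
-- Σ lᵢ = 0 splits into two nonnegative representations of one point with
-- disjoint supports, which must then be empty.
module Simplices where

  open import Data.Nat using (suc)
  import Data.Nat.Properties as ℕₚ
  open import Data.Rational
  open import Data.Rational.Properties
  open import Data.Rational.Solver using (module +-*-Solver)
  open +-*-Solver using (solve; _:+_; _:-_; _:*_; _:=_; :-_; con)
  open import Data.List.Membership.Propositional using (_∈_)
  import Data.List.Relation.Unary.All.Properties as Allₚ
  open import Data.Sum using (_⊎_; inj₁; inj₂)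
  open import Data.List.Relation.Binary.Sublist.Propositional using (_⊆_; []; _∷_; _∷ʳ_)
  open import Data.List.Relation.Binary.Sublist.Propositional.Properties using (All-resp-⊆)

  AllPairs-resp-⊆ : ∀ {A : Set} {R : A → A → Set} {D F : List A} → D ⊆ F → AllPairs R F → AllPairs R D
  AllPairs-resp-⊆ [] [] = []
  AllPairs-resp-⊆ (_ ∷ʳ D⊆F) (_ ∷ RF) = AllPairs-resp-⊆ D⊆F RF
  AllPairs-resp-⊆ (refl ∷ D⊆F) (Rx ∷ RF) = All-resp-⊆ D⊆F Rx ∷ AllPairs-resp-⊆ D⊆F RF

  stable-sorted-⊆ : ∀ {n k r} (C D : List (Subset n)) → StableSortedCollection n k r C → D ⊆ C →
    StableSortedCollection n k r D
  stable-sorted-⊆ C D ((sized , sorted) , stable) D⊆C =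
    (All-resp-⊆ D⊆C sized , AllPairs-resp-⊆ D⊆C sorted) , All-resp-⊆ D⊆C stable

  sorted⇒balancedList : ∀ {n} (C : List (Subset n)) →
    AllPairs (λ I J → (I ≢ J) × SortedPair I J) C → BalancedList C
  sorted⇒balancedList C = AllPairs.map (λ {I} {J} p → sorted⇒balanced I J (proj₂ p))

  supportWeights : ∀ {n} → List ℚ → List (Subset n) → List ℚ
  supportWeights (l ∷ ls) (S ∷ C) with l ≟ 0ℚ
  ... | yes _ = supportWeights ls C
  ... | no _ = l ∷ supportWeights ls C
  supportWeights _ _ = []

  supportSets : ∀ {n} → List ℚ → List (Subset n) → List (Subset n)
  supportSets (l ∷ ls) (S ∷ C) with l ≟ 0ℚ
  ... | yes _ = supportSets ls C
  ... | no _ = S ∷ supportSets ls C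
  supportSets _ _ = []

  supportSets-carried : ∀ {n} ls (C : List (Subset n)) → All (Carries 0ℚ ls C) (supportSets ls C)
  supportSets-carried (l ∷ ls) (S ∷ C) with l ≟ 0ℚ
  ... | yes _ = All.map inj₂ (supportSets-carried ls C)
  ... | no l≢0 = inj₁ (l≢0 , refl) ∷ All.map inj₂ (supportSets-carried ls C)
  supportSets-carried [] C = []
  supportSets-carried (l ∷ ls) [] = []

  restrict-to-support : ∀ {n} (C : List (Subset n)) x ls → length ls ≡ length C →
    All (0ℚ ≤_) ls → sumℚ ls ≡ 1ℚ → (∀ i → x i ≡ lincomb ls (map ε C) i) →
    InConv (map ε (supportSets ls C)) x
  restrict-to-support C x ls len 0≤ls sum≡1 x≡ =
    supportWeights ls C , same-length ls C , nonneg ls C 0≤ls , trans (same-sum ls C len) sum≡1 ,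
    λ i → trans (x≡ i) (sym (same-lincomb ls C i))
    where
    same-length : ∀ ls (C : List (Subset _)) →
      length (supportWeights ls C) ≡ length (map ε (supportSets ls C))
    same-length (l ∷ ls) (S ∷ C) with l ≟ 0ℚ
    ... | yes _ = same-length ls C
    ... | no _ = cong suc (same-length ls C)
    same-length [] C = refl
    same-length (l ∷ ls) [] = refl
    nonneg : ∀ ls (C : List (Subset _)) → All (0ℚ ≤_) ls → All (0ℚ ≤_) (supportWeights ls C)
    nonneg (l ∷ ls) (S ∷ C) (0≤l ∷ 0≤ls) with l ≟ 0ℚ
    ... | yes _ = nonneg ls C 0≤ls
    ... | no _ = 0≤l ∷ nonneg ls C 0≤ls
    nonneg [] C _ = []
    nonneg (l ∷ ls) [] _ = []
    same-sum : ∀ ls (C : List (Subset _)) → length ls ≡ length C →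
      sumℚ (supportWeights ls C) ≡ sumℚ ls
    same-sum [] [] _ = refl
    same-sum (l ∷ ls) (S ∷ C) len with l ≟ 0ℚ
    ... | yes refl = trans (same-sum ls C (ℕₚ.suc-injective len)) (sym (+-identityˡ _))
    ... | no _ = cong (l +_) (same-sum ls C (ℕₚ.suc-injective len))
    same-lincomb : ∀ ls (C : List (Subset _)) i →
      lincomb (supportWeights ls C) (map ε (supportSets ls C)) i ≡ lincomb ls (map ε C) i
    same-lincomb (l ∷ ls) (S ∷ C) i with l ≟ 0ℚ
    ... | yes refl = trans (same-lincomb ls C i)
      (sym (trans (cong (_+ lincomb ls (map ε C) i) (*-zeroˡ (ε S i))) (+-identityˡ _)))
    ... | no _ = cong (l * ε S i +_) (same-lincomb ls C i)
    same-lincomb [] C i = refl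
    same-lincomb (l ∷ ls) [] i = refl

  common-face : ∀ {n} (C C' : List (Subset n)) x → BalancedList C → BalancedList C' →
    InConv (map ε C) x → InConv (map ε C') x →
    Σ (List (Subset n)) λ D → All (_∈ C) D × All (_∈ C') D × InConv (map ε D) x
  common-face C C' x bal bal' (ls , len , 0≤ls , sum≡1 , x≡) (ls' , len' , 0≤ls' , sum'≡1 , x≡') =
    supportSets ls C ,
    All.map (carries⇒∈ ls C) (supportSets-carried ls C) ,
    All.map (λ {T} carried → carries⇒∈ ls' C' (support-⊆ C C' ls ls' bal bal' lenC lenC' 0≤ls 0≤ls'
      (trans sum≡1 (sym sum'≡1)) (λ i → trans (sym (x≡ i)) (x≡' i)) T carried))
      (supportSets-carried ls C) ,
    restrict-to-support C x ls lenC 0≤ls sum≡1 x≡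
    where
    lenC : length ls ≡ length C
    lenC = trans len (length-map ε C)
    lenC' : length ls' ≡ length C'
    lenC' = trans len' (length-map ε C')

  _⁺ _⁻ : ℚ → ℚ
  l ⁺ with 0ℚ ≤? l
  ... | yes _ = l
  ... | no _ = 0ℚ
  l ⁻ with 0ℚ ≤? l
  ... | yes _ = 0ℚ
  ... | no _ = - l

  ⁺-⁻ : ∀ l → l ≡ l ⁺ - l ⁻
  ⁺-⁻ l with 0ℚ ≤? l
  ... | yes _ = solve 1 (λ l → l := l :- con 0ℚ) refl l
  ... | no _ = solve 1 (λ l → l := con 0ℚ :- (:- l)) refl l

  ⁺-nonneg : ∀ l → 0ℚ ≤ l ⁺
  ⁺-nonneg l with 0ℚ ≤? l
  ... | yes 0≤l = 0≤l
  ... | no _ = ≤-refl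

  ⁻-nonneg : ∀ l → 0ℚ ≤ l ⁻
  ⁻-nonneg l with 0ℚ ≤? l
  ... | yes _ = ≤-refl
  ... | no 0≰l = <⇒≤ (neg-antimono-< (≰⇒> 0≰l))

  ⁺⁻-disjoint : ∀ l → l ⁺ ≢ 0ℚ → l ⁻ ≢ 0ℚ → ⊥
  ⁺⁻-disjoint l with 0ℚ ≤? l
  ... | yes _ = λ _ 0≢0 → 0≢0 refl
  ... | no _ = λ 0≢0 _ → 0≢0 refl

  ⁺⁻-nonzero : ∀ l → l ≢ 0ℚ → (l ⁺ ≢ 0ℚ) ⊎ (l ⁻ ≢ 0ℚ)
  ⁺⁻-nonzero l l≢0 with 0ℚ ≤? l
  ... | yes _ = inj₁ l≢0
  ... | no _ = inj₂ (λ -l≡0 → l≢0 (trans (solve 1 (λ l → l := :- (:- l)) refl l) (cong -_ -l≡0)))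

  sum-⁺⁻ : ∀ ls → sumℚ ls ≡ sumℚ (map _⁺ ls) - sumℚ (map _⁻ ls)
  sum-⁺⁻ [] = refl
  sum-⁺⁻ (l ∷ ls) = trans (cong₂ _+_ (⁺-⁻ l) (sum-⁺⁻ ls))
    (solve 4 (λ a b c d → (a :- b) :+ (c :- d) := (a :+ c) :- (b :+ d)) refl (l ⁺) (l ⁻) _ _)

  lincomb-⁺⁻ : ∀ {n} ls (C : List (Subset n)) i →
    lincomb ls (map ε C) i ≡ lincomb (map _⁺ ls) (map ε C) i - lincomb (map _⁻ ls) (map ε C) i
  lincomb-⁺⁻ [] C i = refl
  lincomb-⁺⁻ (l ∷ ls) [] i = refl
  lincomb-⁺⁻ (l ∷ ls) (S ∷ C) i = trans (cong₂ (λ a b → a * ε S i + b) (⁺-⁻ l) (lincomb-⁺⁻ ls C i))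
    (solve 5 (λ p q v r s → (p :- q) :* v :+ (r :- s) := (p :* v :+ r) :- (q :* v :+ s))
      refl (l ⁺) (l ⁻) (ε S i) _ _)

  difference-zero : ∀ p q → p - q ≡ 0ℚ → p ≡ q
  difference-zero p q p-q≡0 =
    trans (solve 2 (λ p q → p := (p :- q) :+ q) refl p q) (trans (cong (_+ q) p-q≡0) (+-identityˡ q))

  parts-disjoint : ∀ {n} ls (C : List (Subset n)) → AllPairs _≢_ C → ∀ T →
    Carries 0ℚ (map _⁺ ls) C T → Carries 0ℚ (map _⁻ ls) C T → ⊥
  parts-disjoint (l ∷ ls) (S ∷ C) _ T (inj₁ (l⁺≢0 , refl)) (inj₁ (l⁻≢0 , _)) = ⁺⁻-disjoint l l⁺≢0 l⁻≢0
  parts-disjoint (l ∷ ls) (S ∷ C) (S∉C ∷ _) T (inj₁ (_ , refl)) (inj₂ carried) =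
    All.lookup S∉C (carries⇒∈ (map _⁻ ls) C carried) refl
  parts-disjoint (l ∷ ls) (S ∷ C) (S∉C ∷ _) T (inj₂ carried) (inj₁ (_ , refl)) =
    All.lookup S∉C (carries⇒∈ (map _⁺ ls) C carried) refl
  parts-disjoint (l ∷ ls) (S ∷ C) (_ ∷ distinct) T (inj₂ carried⁺) (inj₂ carried⁻) =
    parts-disjoint ls C distinct T carried⁺ carried⁻

  parts-empty⇒zero : ∀ {n} ls (C : List (Subset n)) → length ls ≡ length C →
    (∀ T → ¬ Carries 0ℚ (map _⁺ ls) C T) → (∀ T → ¬ Carries 0ℚ (map _⁻ ls) C T) → All (_≡ 0ℚ) ls
  parts-empty⇒zero [] [] _ _ _ = []
  parts-empty⇒zero (l ∷ ls) (S ∷ C) len none⁺ none⁻ with l ≟ 0ℚ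
  ... | yes l≡0 = l≡0 ∷ parts-empty⇒zero ls C (ℕₚ.suc-injective len)
                         (λ T carried → none⁺ T (inj₂ carried)) (λ T carried → none⁻ T (inj₂ carried))
  ... | no l≢0 with ⁺⁻-nonzero l l≢0
  ...   | inj₁ l⁺≢0 = ⊥-elim (none⁺ S (inj₁ (l⁺≢0 , refl)))
  ...   | inj₂ l⁻≢0 = ⊥-elim (none⁻ S (inj₁ (l⁻≢0 , refl)))

  affinely-independent : ∀ {n} (C : List (Subset n)) → AllPairs _≢_ C → BalancedList C →
    AffinelyIndependent (map ε C)
  affinely-independent C distinct bal ls len sum≡0 lincomb≡0 = parts-empty⇒zero ls C lenC
    (λ T carried⁺ → parts-disjoint ls C distinct T carried⁺
      (support-⊆ C C (map _⁺ ls) (map _⁻ ls) bal bal len⁺ len⁻ 0≤⁺ 0≤⁻ same-sum same-point T carried⁺))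
    (λ T carried⁻ → parts-disjoint ls C distinct T
      (support-⊆ C C (map _⁻ ls) (map _⁺ ls) bal bal len⁻ len⁺ 0≤⁻ 0≤⁺ (sym same-sum)
        (λ i → sym (same-point i)) T carried⁻) carried⁻)
    where
    lenC : length ls ≡ length C
    lenC = trans len (length-map ε C)
    len⁺ : length (map _⁺ ls) ≡ length C
    len⁺ = trans (length-map _⁺ ls) lenC
    len⁻ : length (map _⁻ ls) ≡ length C
    len⁻ = trans (length-map _⁻ ls) lenC
    0≤⁺ : All (0ℚ ≤_) (map _⁺ ls)
    0≤⁺ = Allₚ.map⁺ (All.universal ⁺-nonneg ls)
    0≤⁻ : All (0ℚ ≤_) (map _⁻ ls)
    0≤⁻ = Allₚ.map⁺ (All.universal ⁻-nonneg ls)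
    same-sum : sumℚ (map _⁺ ls) ≡ sumℚ (map _⁻ ls)
    same-sum = difference-zero _ _ (trans (sym (sum-⁺⁻ ls)) sum≡0)
    same-point : ∀ i → lincomb (map _⁺ ls) (map ε C) i ≡ lincomb (map _⁻ ls) (map ε C) i
    same-point i = difference-zero _ _ (trans (sym (lincomb-⁺⁻ ls C i)) (lincomb≡0 i))

open Simplices

-- Cyclic filling: a balanced list with prescribed column counts.
--
-- Given N = suc N' slots and column counts c₀ … c_{n-1}, each ≤ N, walk a
-- cursor around the N slots: element i is put into the c_i slots following
-- the cursor, which then advances by c_i (mod N).  After the first v
-- elements the cursor has made  rounds v  full rounds and stands at
-- cursor v < N, where  rounds v · N + cursor v = c₀ + … + c_{v-1}, and slot j
-- has received exactly  rounds v + [j < cursor v]  elements below v.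
-- Hence the N slots form a balanced list with column counts cᵢ.
module CyclicFilling where

  open import Data.Nat using (ℕ; zero; suc; _≤_; _<_; z≤n; s≤s; _+_; _*_; _∸_; _<?_; _≤?_)
  open import Data.Nat.Properties
  open import Data.Nat.ListAction using (sum)
  open import Data.List using (applyUpTo)
  open import Data.List.Properties using (map-applyUpTo; length-applyUpTo)
  open import Data.Fin using (zero)
  open import Data.Vec.Relation.Unary.All as AllV using ([]; _∷_) renaming (All to AllV)
  open import Algebra.Properties.CommutativeSemigroup +-commutativeSemigroup using (interchange)

  passed : ℕ → ℕ → ℕ
  passed j o with j <? o
  ... | yes _ = 1
  ... | no _ = 0

  passed≤1 : ∀ j o → passed j o ≤ 1
  passed≤1 j o with j <? o
  ... | yes _ = s≤s z≤n
  ... | no _ = z≤n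

  passed-yes : ∀ {j o} → j < o → passed j o ≡ 1
  passed-yes {j} {o} j<o with j <? o
  ... | yes _ = refl
  ... | no j≮o = ⊥-elim (j≮o j<o)

  passed-no : ∀ {j o} → ¬ j < o → passed j o ≡ 0
  passed-no {j} {o} j≮o with j <? o
  ... | yes j<o = ⊥-elim (j≮o j<o)
  ... | no _ = refl

  passed-monoʳ : ∀ {j o o'} → o ≤ o' → passed j o ≤ passed j o'
  passed-monoʳ {j} {o} o≤o' with j <? o
  ... | yes j<o = ≤-reflexive (sym (passed-yes (≤-trans j<o o≤o')))
  ... | no _ = z≤n

  passed-antiˡ : ∀ {i j o} → i ≤ j → passed j o ≤ passed i o
  passed-antiˡ {i} {j} {o} i≤j with j <? o
  ... | yes j<o = ≤-reflexive (sym (passed-yes (≤-<-trans i≤j j<o)))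
  ... | no _ = z≤n

  passed-suc : ∀ j o → passed (suc j) (suc o) ≡ passed j o
  passed-suc j o with j <? o
  ... | yes j<o = passed-yes (s≤s j<o)
  ... | no j≮o = passed-no (λ 1+j<1+o → j≮o (≤-pred 1+j<1+o))

  sum-applyUpTo-cong : ∀ m (f g : ℕ → ℕ) → (∀ j → j < m → f j ≡ g j) →
    sum (applyUpTo f m) ≡ sum (applyUpTo g m)
  sum-applyUpTo-cong zero f g _ = refl
  sum-applyUpTo-cong (suc m) f g f≗g = cong₂ _+_ (f≗g 0 (s≤s z≤n))
    (sum-applyUpTo-cong m (λ j → f (suc j)) (λ j → g (suc j)) (λ j j<m → f≗g (suc j) (s≤s j<m)))

  sum-passed : ∀ m o → o ≤ m → sum (applyUpTo (λ j → passed j o) m) ≡ o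
  sum-passed zero zero _ = refl
  sum-passed (suc m) zero _ = sum-passed m 0 z≤n
  sum-passed (suc m) (suc o) (s≤s o≤m) =
    cong suc (trans (sum-applyUpTo-cong m _ _ (λ j _ → passed-suc j o)) (sum-passed m o o≤m))

  sum-applyUpTo-+ : ∀ m Q (h : ℕ → ℕ) → sum (applyUpTo (λ j → Q + h j) m) ≡ m * Q + sum (applyUpTo h m)
  sum-applyUpTo-+ zero Q h = refl
  sum-applyUpTo-+ (suc m) Q h =
    trans (cong (Q + h 0 +_) (sum-applyUpTo-+ m Q (λ j → h (suc j)))) (interchange Q (h 0) (m * Q) _)

  columns : ∀ {n} → List (Subset n) → Vec ℕ n
  columns {zero} L = []
  columns {suc n} L = column L zero ∷ columns (map Vec.tail L)

  partialSum : ∀ {n} → ℕ → Vec ℕ n → ℕ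
  partialSum zero cs = 0
  partialSum (suc v) [] = 0
  partialSum (suc v) (c ∷ cs) = c + partialSum v cs

  partialSum-columns : ∀ {n} v (L : List (Subset n)) → partialSum v (columns L) ≡ prefixTotal v L
  partialSum-columns zero L = sym (prefixTotal-zero L)
  partialSum-columns {zero} (suc v) L = sym (prefixTotal-empty (suc v) L)
  partialSum-columns {suc n} (suc v) L =
    trans (cong (column L zero +_) (partialSum-columns v (map Vec.tail L))) (sym (prefixTotal-suc v L))

  columns-bounded : ∀ {n m} (L : List (Subset n)) → length L ≡ m → AllV (_≤ m) (columns L)
  columns-bounded {zero} L _ = []
  columns-bounded {suc n} L refl = column≤length L zero ∷
    columns-bounded (map Vec.tail L) (length-map Vec.tail L)

  module Slots (N' : ℕ) where

    N : ℕ
    N = suc N'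

    advance : ℕ → ℕ → ℕ
    advance o c with o + c <? N
    ... | yes _ = o + c
    ... | no _ = o + c ∸ N

    wraps : ℕ → ℕ → ℕ
    wraps o c with o + c <? N
    ... | yes _ = 0
    ... | no _ = 1

    receives : ℕ → ℕ → ℕ → Bool
    receives o c j with o + c <? N | o ≤? j | j <? o + c | j <? o + c ∸ N
    ... | yes _ | yes _ | yes _ | _ = true
    ... | yes _ | _ | _ | _ = false
    ... | no _ | no _ | _ | no _ = false
    ... | no _ | _ | _ | _ = true

    -- the cursor stays in range: c ≤ N makes it wrap at most once, landing
    -- behind its old position, and  o + c = wraps · N + advance
    wrapped≤o : ∀ o c → c ≤ N → o + c ∸ N ≤ o
    wrapped≤o o c c≤N = ≤-trans (∸-monoˡ-≤ N (+-monoʳ-≤ o c≤N)) (≤-reflexive (m+n∸n≡m o N))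

    advance<N : ∀ o c → o < N → c ≤ N → advance o c < N
    advance<N o c o<N c≤N with o + c <? N
    ... | yes o+c<N = o+c<N
    ... | no _ = ≤-<-trans (wrapped≤o o c c≤N) o<N

    advance-wraps : ∀ o c → o + c ≡ wraps o c * N + advance o c
    advance-wraps o c with o + c <? N
    ... | yes _ = refl
    ... | no o+c≮N = sym (trans (cong (_+ (o + c ∸ N)) (+-identityʳ N)) (m+[n∸m]≡n (≮⇒≥ o+c≮N)))

    -- slot j is passed once more exactly when it receives, up to a full wrap
    receives-step : ∀ o c j → o < N → j < N → c ≤ N →
      passed j o + bit (receives o c j) ≡ wraps o c + passed j (advance o c)
    receives-step o c j o<N j<N c≤N with o + c <? N
    ... | yes _ with o ≤? j | j <? o + c | j <? o + c ∸ N | j <? o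
    ...   | yes o≤j | _ | _ | yes j<o = ⊥-elim (<⇒≱ j<o o≤j)
    ...   | yes _ | yes _ | _ | no _ = refl
    ...   | yes _ | no _ | _ | no _ = refl
    ...   | no _ | yes _ | _ | yes _ = refl
    ...   | no o≰j | _ | _ | no j≮o = ⊥-elim (o≰j (≮⇒≥ j≮o))
    ...   | no _ | no j≮o+c | _ | yes j<o = ⊥-elim (j≮o+c (<-≤-trans j<o (m≤m+n o c)))
    receives-step o c j o<N j<N c≤N | no _ with o ≤? j | j <? o + c | j <? o + c ∸ N | j <? o
    ...   | yes o≤j | _ | _ | yes j<o = ⊥-elim (<⇒≱ j<o o≤j)
    ...   | yes o≤j | _ | yes j<o' | no _ = ⊥-elim (<⇒≱ (<-≤-trans j<o' (wrapped≤o o c c≤N)) o≤j)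
    ...   | yes _ | _ | no _ | no _ = refl
    ...   | no _ | _ | yes _ | yes _ = refl
    ...   | no o≰j | _ | _ | no j≮o = ⊥-elim (o≰j (≮⇒≥ j≮o))
    ...   | no _ | _ | no _ | yes _ = refl

    slot : ∀ {n} → ℕ → ℕ → Vec ℕ n → Subset n
    slot o j [] = []
    slot o j (c ∷ cs) = receives o c j ∷ slot (advance o c) j cs

    state : ∀ {n} → ℕ → Vec ℕ n → ℕ → ℕ × ℕ
    state o [] v = 0 , o
    state o (c ∷ cs) zero = 0 , o
    state o (c ∷ cs) (suc v) =
      wraps o c + proj₁ (state (advance o c) cs v) , proj₂ (state (advance o c) cs v)

    prefix-slot : ∀ {n} o j (cs : Vec ℕ n) v → o < N → j < N → AllV (_≤ N) cs →
      passed j o + prefix v (slot o j cs) ≡ proj₁ (state o cs v) + passed j (proj₂ (state o cs v))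
    prefix-slot o j [] zero _ _ _ = +-identityʳ _
    prefix-slot o j [] (suc v) _ _ _ = +-identityʳ _
    prefix-slot o j (c ∷ cs) zero _ _ _ = +-identityʳ _
    prefix-slot o j (c ∷ cs) (suc v) o<N j<N (c≤N ∷ cs≤N) = begin
      passed j o + (bit (receives o c j) + prefix v (slot o' j cs))
        ≡⟨ +-assoc (passed j o) _ _ ⟨
      passed j o + bit (receives o c j) + prefix v (slot o' j cs)
        ≡⟨ cong (_+ prefix v (slot o' j cs)) (receives-step o c j o<N j<N c≤N) ⟩
      wraps o c + passed j o' + prefix v (slot o' j cs)
        ≡⟨ +-assoc (wraps o c) _ _ ⟩
      wraps o c + (passed j o' + prefix v (slot o' j cs))
        ≡⟨ cong (wraps o c +_) (prefix-slot o' j cs v (advance<N o c o<N c≤N) j<N cs≤N) ⟩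
      wraps o c + (proj₁ (state o' cs v) + passed j (proj₂ (state o' cs v)))
        ≡⟨ +-assoc (wraps o c) _ _ ⟨
      wraps o c + proj₁ (state o' cs v) + passed j (proj₂ (state o' cs v)) ∎
      where
      open ≡-Reasoning
      o' : ℕ
      o' = advance o c

    state-invariant : ∀ {n} o (cs : Vec ℕ n) v → o < N → AllV (_≤ N) cs →
      (proj₂ (state o cs v) < N) × (proj₁ (state o cs v) * N + proj₂ (state o cs v) ≡ o + partialSum v cs)
    state-invariant o [] zero o<N _ = o<N , sym (+-identityʳ o)
    state-invariant o [] (suc v) o<N _ = o<N , sym (+-identityʳ o)
    state-invariant o (c ∷ cs) zero o<N _ = o<N , sym (+-identityʳ o)
    state-invariant o (c ∷ cs) (suc v) o<N (c≤N ∷ cs≤N)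
      with state-invariant (advance o c) cs v (advance<N o c o<N c≤N) cs≤N
    ... | O<N , QN+O≡ = O<N , (begin
      (wraps o c + Q) * N + O        ≡⟨ cong (_+ O) (*-distribʳ-+ N (wraps o c) Q) ⟩
      wraps o c * N + Q * N + O      ≡⟨ +-assoc (wraps o c * N) (Q * N) O ⟩
      wraps o c * N + (Q * N + O)    ≡⟨ cong (wraps o c * N +_) QN+O≡ ⟩
      wraps o c * N + (advance o c + partialSum v cs) ≡⟨ +-assoc (wraps o c * N) _ _ ⟨
      wraps o c * N + advance o c + partialSum v cs   ≡⟨ cong (_+ partialSum v cs) (advance-wraps o c) ⟨
      o + c + partialSum v cs        ≡⟨ +-assoc o c (partialSum v cs) ⟩
      o + (c + partialSum v cs) ∎)
      where
      open ≡-Reasoning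
      Q O : ℕ
      Q = proj₁ (state (advance o c) cs v)
      O = proj₂ (state (advance o c) cs v)

    filling : ∀ {n} → Vec ℕ n → List (Subset n)
    filling cs = applyUpTo (λ j → slot 0 j cs) N

    rounds cursor : ∀ {n} → Vec ℕ n → ℕ → ℕ
    rounds cs v = proj₁ (state 0 cs v)
    cursor cs v = proj₂ (state 0 cs v)

    cursor<N : ∀ {n} (cs : Vec ℕ n) v → AllV (_≤ N) cs → cursor cs v < N
    cursor<N cs v cs≤N = proj₁ (state-invariant 0 cs v (s≤s z≤n) cs≤N)

    rounds-cursor : ∀ {n} (cs : Vec ℕ n) v → AllV (_≤ N) cs → rounds cs v * N + cursor cs v ≡ partialSum v cs
    rounds-cursor cs v cs≤N = proj₂ (state-invariant 0 cs v (s≤s z≤n) cs≤N)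

    prefix-filling : ∀ {n} (cs : Vec ℕ n) j v → j < N → AllV (_≤ N) cs →
      prefix v (slot 0 j cs) ≡ rounds cs v + passed j (cursor cs v)
    prefix-filling cs j v j<N cs≤N = prefix-slot 0 j cs v (s≤s z≤n) j<N cs≤N

    length-filling : ∀ {n} (cs : Vec ℕ n) → length (filling cs) ≡ N
    length-filling cs = length-applyUpTo (λ j → slot 0 j cs) N

    -- earlier slots have passed the cursor at least as often, by at most one
    filling-balanced : ∀ {n} (cs : Vec ℕ n) → AllV (_≤ N) cs → BalancedList (filling cs)
    filling-balanced cs cs≤N = AllPairsₚ.applyUpTo⁺₁ (λ j → slot 0 j cs) N balanced-slots
      where
      balanced-slots : ∀ {i j} → i < j → j < N → Balanced (slot 0 i cs) (slot 0 j cs)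
      balanced-slots {i} {j} i<j j<N v
        rewrite prefix-filling cs i v (<-trans i<j j<N) cs≤N | prefix-filling cs j v j<N cs≤N =
        +-monoʳ-≤ (rounds cs v) (passed-antiˡ (<⇒≤ i<j)) , (begin
          rounds cs v + passed i (cursor cs v)  ≤⟨ +-monoʳ-≤ (rounds cs v) (passed≤1 i (cursor cs v)) ⟩
          rounds cs v + 1                       ≡⟨ +-comm (rounds cs v) 1 ⟩
          suc (rounds cs v)                     ≤⟨ s≤s (m≤m+n (rounds cs v) _) ⟩
          suc (rounds cs v + passed j (cursor cs v)) ∎)
        where open ≤-Reasoning

    filling-prefixTotal : ∀ {n} (cs : Vec ℕ n) v → AllV (_≤ N) cs → prefixTotal v (filling cs) ≡ partialSum v cs
    filling-prefixTotal cs v cs≤N = begin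
      sum (map (prefix v) (applyUpTo (λ j → slot 0 j cs) N))
        ≡⟨ cong sum (map-applyUpTo (λ j → slot 0 j cs) (prefix v) N) ⟩
      sum (applyUpTo (λ j → prefix v (slot 0 j cs)) N)
        ≡⟨ sum-applyUpTo-cong N _ _ (λ j j<N → prefix-filling cs j v j<N cs≤N) ⟩
      sum (applyUpTo (λ j → Q + passed j O) N)
        ≡⟨ sum-applyUpTo-+ N Q (λ j → passed j O) ⟩
      N * Q + sum (applyUpTo (λ j → passed j O) N)
        ≡⟨ cong (N * Q +_) (sum-passed N O (<⇒≤ (cursor<N cs v cs≤N))) ⟩
      N * Q + O   ≡⟨ cong (_+ O) (*-comm N Q) ⟩
      Q * N + O   ≡⟨ rounds-cursor cs v cs≤N ⟩
      partialSum v cs ∎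
      where
      open ≡-Reasoning
      Q O : ℕ
      Q = rounds cs v
      O = cursor cs v

    division-unique : ∀ Q O k → Q * N + O ≡ k * N → O < N → (O ≡ 0) × (Q ≡ k)
    division-unique Q O k eq O<N with <-cmp Q k
    ... | tri< Q<k _ _ = ⊥-elim (<-irrefl eq (begin-strict
        Q * N + O   <⟨ +-monoʳ-< (Q * N) O<N ⟩
        Q * N + N   ≡⟨ +-comm (Q * N) N ⟩
        suc Q * N   ≤⟨ *-monoˡ-≤ N Q<k ⟩
        k * N ∎))
      where open ≤-Reasoning
    ... | tri> _ _ k<Q = ⊥-elim (<-irrefl (sym eq) (begin-strict
        k * N       <⟨ m<m+n (k * N) (s≤s z≤n) ⟩
        k * N + N   ≡⟨ +-comm (k * N) N ⟩
        suc k * N   ≤⟨ *-monoˡ-≤ N k<Q ⟩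
        Q * N       ≤⟨ m≤m+n (Q * N) O ⟩
        Q * N + O ∎))
      where open ≤-Reasoning
    ... | tri≈ _ refl _ = +-cancelˡ-≡ (Q * N) O 0 (trans eq (sym (+-identityʳ _))) , refl

    filling-size : ∀ {n} (cs : Vec ℕ n) k j → j < N → AllV (_≤ N) cs →
      partialSum n cs ≡ k * N → prefix n (slot 0 j cs) ≡ k
    filling-size {n} cs k j j<N cs≤N total with
      division-unique (rounds cs n) (cursor cs n) k (trans (rounds-cursor cs n cs≤N) total) (cursor<N cs n cs≤N)
    ... | O≡0 , Q≡k = begin
      prefix n (slot 0 j cs)                ≡⟨ prefix-filling cs j n j<N cs≤N ⟩
      rounds cs n + passed j (cursor cs n)  ≡⟨ cong₂ (λ Q O → Q + passed j O) Q≡k O≡0 ⟩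
      k + passed j 0                        ≡⟨ cong (k +_) (passed-no {j} {0} λ ()) ⟩
      k + 0                                 ≡⟨ +-identityʳ k ⟩
      k ∎
      where open ≡-Reasoning

open CyclicFilling

-- The slots of the filling of r-stable k-sets are r-stable k-sets.
--
-- An r-stable set S has at most one element in every window of r
-- consecutive positions, cyclically.  In prefix counts: prefix v' S ≤
-- 1 + prefix v S when v' ≤ v + r, and  prefix (i+1) S + |S| ≤ 1 + prefix i' S
-- for the wrapping window  [i' , n) ∪ [0 , i].  Summing over a list E of N
-- such sets bounds the prefix totals of E, and these bounds pass to each
-- slot of the filling of E, whose prefix counts are  rounds + [j < cursor]
-- with  rounds · N + cursor = prefix total.
module Stability where

  open import Data.Nat using (ℕ; zero; suc; _≤_; _<_; z≤n; s≤s; _+_; _*_; _∸_; _⊓_; _<?_; _≤?_)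
  open import Data.Nat.Properties
  open import Data.Nat.ListAction using (sum)
  open import Algebra.Properties.CommutativeSemigroup +-commutativeSemigroup using (interchange; x∙yz≈y∙xz; xy∙z≈xz∙y)
  open import Data.Nat.Tactic.RingSolver using (solve-∀)
  open import Data.Fin using (zero; suc)
  import Data.Fin.Properties as Finₚ
  import Data.Vec.Properties as Vecₚ
  open import Data.Vec.Relation.Unary.All using () renaming (All to AllV)
  open ≤-Reasoning

  prefix-[] : ∀ v → prefix v ([] {A = Bool}) ≡ 0
  prefix-[] zero = refl
  prefix-[] (suc v) = refl

  element-between : ∀ {n} (S : Subset n) v v' → prefix v S < prefix v' S →
    Σ (Fin n) λ a → (v ≤ toℕ a) × (toℕ a < v') × (lookup S a ≡ true)
  element-between [] v v' grows rewrite prefix-[] v | prefix-[] v' = ⊥-elim (<-irrefl refl grows)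
  element-between (b ∷ S) v zero ()
  element-between (true ∷ S) zero (suc v') _ = zero , z≤n , s≤s z≤n , refl
  element-between (false ∷ S) zero (suc v') grows with element-between S 0 v' grows
  ... | a , _ , a<v' , a∈S = suc a , z≤n , s≤s a<v' , a∈S
  element-between (b ∷ S) (suc v) (suc v') grows with element-between S v v' (+-cancelˡ-< (bit b) _ _ grows)
  ... | a , v≤a , a<v' , a∈S = suc a , s≤s v≤a , s≤s a<v' , a∈S

  prefix-mono : ∀ {n} (S : Subset n) {v v'} → v ≤ v' → prefix v S ≤ prefix v' S
  prefix-mono S {zero} _ = z≤n
  prefix-mono [] {suc v} {suc v'} _ = z≤n
  prefix-mono (b ∷ S) {suc v} {suc v'} (s≤s v≤v') = +-monoʳ-≤ (bit b) (prefix-mono S v≤v')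

  prefix-step : ∀ {n} (S : Subset n) (a : Fin n) → lookup S a ≡ true →
    prefix (suc (toℕ a)) S ≡ suc (prefix (toℕ a) S)
  prefix-step (true ∷ S) zero _ = refl
  prefix-step (b ∷ S) (suc a) a∈S = trans (cong (bit b +_) (prefix-step S a a∈S)) (+-suc (bit b) _)

  prefix-full : ∀ {n} (S : Subset n) → prefix n S ≡ ∣ S ∣
  prefix-full [] = refl
  prefix-full (true ∷ S) = cong suc (prefix-full S)
  prefix-full (false ∷ S) = prefix-full S

  prefix≤full : ∀ {n} (S : Subset n) v → prefix v S ≤ prefix n S
  prefix≤full [] v = ≤-reflexive (prefix-[] v)
  prefix≤full (b ∷ S) zero = z≤n
  prefix≤full (b ∷ S) (suc v) = +-monoʳ-≤ (bit b) (prefix≤full S v)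

  prefix-two-elements : ∀ {n} (S : Subset n) (a b : Fin n) → toℕ a < toℕ b →
    lookup S a ≡ true → lookup S b ≡ true → suc (suc (prefix (toℕ a) S)) ≤ prefix (suc (toℕ b)) S
  prefix-two-elements S a b a<b a∈S b∈S = begin
    suc (suc (prefix (toℕ a) S)) ≡⟨ cong suc (prefix-step S a a∈S) ⟨
    suc (prefix (suc (toℕ a)) S) ≤⟨ s≤s (prefix-mono S a<b) ⟩
    suc (prefix (toℕ b) S)       ≡⟨ prefix-step S b b∈S ⟨
    prefix (suc (toℕ b)) S ∎

  Gapped : ∀ {n} → ℕ → Subset n → Set
  Gapped {n} r S = ∀ a b → toℕ a < toℕ b → lookup S a ≡ true → lookup S b ≡ true →
    (r ≤ toℕ b ∸ toℕ a) × (r ≤ n ∸ (toℕ b ∸ toℕ a))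

  cd-ordered : ∀ {n} (a b : Fin n) → toℕ a < toℕ b → cd a b ≡ (toℕ b ∸ toℕ a) ⊓ (n ∸ (toℕ b ∸ toℕ a))
  cd-ordered {n} a b a<b = cong (λ d → d ⊓ (n ∸ d)) (m≤n⇒∣m-n∣≡n∸m (<⇒≤ a<b))

  stable⇒gapped : ∀ {n r} (S : Subset n) → RStable r S → Gapped r S
  stable⇒gapped {n} {r} S stable a b a<b a∈S b∈S = m≤n⊓o⇒m≤n _ _ r≤cd , m≤n⊓o⇒m≤o _ _ r≤cd
    where
    r≤cd : r ≤ (toℕ b ∸ toℕ a) ⊓ (n ∸ (toℕ b ∸ toℕ a))
    r≤cd = subst (r ≤_) (cd-ordered a b a<b) (stable a b (Vecₚ.lookup⇒[]= a S a∈S)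
      (Vecₚ.lookup⇒[]= b S b∈S) (λ a≡b → <-irrefl (cong toℕ a≡b) a<b))

  gapped⇒stable : ∀ {n r} (S : Subset n) → Gapped r S → RStable r S
  gapped⇒stable {n} {r} S gapped a b a∈S b∈S a≢b with <-cmp (toℕ a) (toℕ b)
  ... | tri< a<b _ _ = subst (r ≤_) (sym (cd-ordered a b a<b))
        (uncurry ⊓-glb (gapped a b a<b (Vecₚ.[]=⇒lookup a∈S) (Vecₚ.[]=⇒lookup b∈S)))
  ... | tri≈ _ a≡b _ = ⊥-elim (a≢b (Finₚ.toℕ-injective a≡b))
  ... | tri> _ _ b<a = subst (r ≤_) (trans (sym (cd-ordered b a b<a)) cd-sym)
        (uncurry ⊓-glb (gapped b a b<a (Vecₚ.[]=⇒lookup b∈S) (Vecₚ.[]=⇒lookup a∈S)))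
    where
    cd-sym : cd b a ≡ cd a b
    cd-sym = cong (λ d → d ⊓ (n ∸ d)) (∣-∣-comm (toℕ b) (toℕ a))

  gap-violated : ∀ {a b r} → a ≤ b → b < a + r → ¬ (r ≤ b ∸ a)
  gap-violated {a} {b} {r} a≤b b<a+r r≤b-a = <-irrefl refl (begin-strict
    b              <⟨ b<a+r ⟩
    a + r          ≤⟨ +-monoʳ-≤ a r≤b-a ⟩
    a + (b ∸ a)    ≡⟨ m+[n∸m]≡n a≤b ⟩
    b ∎)

  cyclic-gap-violated : ∀ {n a b r} → a ≤ b → b ≤ n → n + a < b + r → ¬ (r ≤ n ∸ (b ∸ a))
  cyclic-gap-violated {n} {a} {b} {r} a≤b b≤n wraps r≤ = <-irrefl refl (begin-strict
    n + a                          <⟨ wraps ⟩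
    b + r                          ≤⟨ +-monoʳ-≤ b r≤ ⟩
    b + (n ∸ (b ∸ a))              ≡⟨ cong (_+ (n ∸ (b ∸ a))) (m+[n∸m]≡n a≤b) ⟨
    a + (b ∸ a) + (n ∸ (b ∸ a))    ≡⟨ +-assoc a _ _ ⟩
    a + ((b ∸ a) + (n ∸ (b ∸ a)))  ≡⟨ cong (a +_) (m+[n∸m]≡n (≤-trans (m∸n≤m b a) b≤n)) ⟩
    a + n                          ≡⟨ +-comm a n ⟩
    n + a ∎)

  window-bound : ∀ {n r} (S : Subset n) → Gapped r S → ∀ v v' → v' ≤ v + r →
    prefix v' S ≤ suc (prefix v S)
  window-bound S gapped v v' short with prefix v' S ≤? suc (prefix v S)
  ... | yes bounded = bounded
  ... | no unbounded with element-between S v v' (≤-trans (n≤1+n _) (≰⇒> unbounded))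
  ...   | a , v≤a , a<v' , a∈S with prefix v S <? prefix (toℕ a) S
  ...     | yes grows with element-between S v (toℕ a) grows
  ...       | b , v≤b , b<a , b∈S = ⊥-elim (gap-violated (<⇒≤ b<a)
              (<-≤-trans a<v' (≤-trans short (+-monoˡ-≤ _ v≤b))) (proj₁ (gapped b a b<a b∈S a∈S)))
  window-bound S gapped v v' short | no unbounded | a , v≤a , a<v' , a∈S | no flat
    with element-between S (suc (toℕ a)) v' (begin-strict
           prefix (suc (toℕ a)) S ≡⟨ prefix-step S a a∈S ⟩
           suc (prefix (toℕ a) S) ≤⟨ s≤s (≮⇒≥ flat) ⟩
           suc (prefix v S)       <⟨ ≰⇒> unbounded ⟩
           prefix v' S ∎)
  ... | b , a<b , b<v' , b∈S = ⊥-elim (gap-violated (<⇒≤ a<b)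
          (<-≤-trans b<v' (≤-trans short (+-monoˡ-≤ _ v≤a))) (proj₁ (gapped a b a<b a∈S b∈S)))

  -- the wrapping window [i' , n) ∪ [0 , i] contains at most one element
  cyclic-window-bound : ∀ {n r} (S : Subset n) → Gapped r S → ∀ i i' → i < i' → i' ≤ n →
    n + i < i' + r → prefix (suc i) S + prefix n S ≤ suc (prefix i' S)
  cyclic-window-bound {n} {r} S gapped i i' i<i' i'≤n wraps with prefix n S ≤? prefix i' S
  ... | yes tail-empty = +-mono-≤ (window-bound S gapped 0 (suc i) 1+i≤r) tail-empty
    where
    1+i≤r : suc i ≤ r
    1+i≤r = +-cancelˡ-< i' i r (≤-<-trans (+-monoˡ-≤ i i'≤n) wraps)
  ... | no tail-nonempty with element-between S i' n (≰⇒> tail-nonempty)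
  ...   | b , i'≤b , _ , b∈S with 0 <? prefix (suc i) S
  ...     | yes head-nonempty with element-between S 0 (suc i) head-nonempty
  ...       | a , _ , a<1+i , a∈S = ⊥-elim (cyclic-gap-violated (<⇒≤ a<b) (<⇒≤ (Finₚ.toℕ<n b))
              (begin-strict
                n + toℕ a <⟨ ≤-<-trans (+-monoʳ-≤ n (≤-pred a<1+i)) wraps ⟩
                i' + r    ≤⟨ +-monoˡ-≤ r i'≤b ⟩
                toℕ b + r ∎)
              (proj₂ (gapped a b a<b a∈S b∈S)))
      where
      a<b : toℕ a < toℕ b
      a<b = <-≤-trans (≤-<-trans (≤-pred a<1+i) i<i') i'≤b
  cyclic-window-bound {n} {r} S gapped i i' i<i' i'≤n wraps | no _ | _ | no head-empty
    rewrite n≤0⇒n≡0 (≮⇒≥ head-empty) =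
    window-bound S gapped i' n (<⇒≤ (≤-<-trans (m≤m+n n i) wraps))

  summed-bound : ∀ {n} (f g : Subset n → ℕ) m (E : List (Subset n)) →
    All (λ S → f S + m ≤ suc (g S)) E →
    sum (map f E) + length E * m ≤ length E + sum (map g E)
  summed-bound f g m [] [] = z≤n
  summed-bound f g m (S ∷ E) (bound ∷ bounds) = begin
    f S + sum (map f E) + (m + length E * m)     ≡⟨ interchange (f S) _ m _ ⟩
    (f S + m) + (sum (map f E) + length E * m)   ≤⟨ +-mono-≤ bound (summed-bound f g m E bounds) ⟩
    suc (g S) + (length E + sum (map g E))       ≡⟨ cong suc (x∙yz≈y∙xz (g S) (length E) _) ⟩
    suc (length E + (g S + sum (map g E))) ∎

  close⇒short : ∀ {a b r} → a ≤ b → b ∸ a < r → b < a + r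
  close⇒short {a} {b} {r} a≤b b-a<r = subst (_< a + r) (m+[n∸m]≡n a≤b) (+-monoʳ-< a b-a<r)

  close⇒wraps : ∀ {n a b r} → a ≤ b → b ≤ n → n ∸ (b ∸ a) < r → n + a < b + r
  close⇒wraps {n} {a} {b} {r} a≤b b≤n n-d<r = begin-strict
    n + a                    ≡⟨ cong (_+ a) (m∸n+n≡m d≤n) ⟨
    (n ∸ d) + d + a          ≡⟨ +-assoc (n ∸ d) d a ⟩
    (n ∸ d) + (d + a)        ≡⟨ cong ((n ∸ d) +_) (m∸n+n≡m a≤b) ⟩
    (n ∸ d) + b              <⟨ +-monoˡ-< b n-d<r ⟩
    r + b                    ≡⟨ +-comm r b ⟩
    b + r ∎
    where
    d : ℕ
    d = b ∸ a
    d≤n : d ≤ n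
    d≤n = ≤-trans (m∸n≤m b a) b≤n

  module _ (N' : ℕ) where
    open Slots N'

    regroup : ∀ Q O m → Q * N + O + N * m ≡ (Q + m) * N + O
    regroup Q O m = regroup-∀ Q O m N
      where
      regroup-∀ : ∀ Q O m N → Q * N + O + N * m ≡ (Q + m) * N + O
      regroup-∀ = solve-∀

    -- bounds on totals  Q·N + O  pass to the slot counts  Q + [j < O]
    transfer : ∀ j Q O Q' O' m → O < N → O' < N →
      Q * N + O + N * m ≤ N + (Q' * N + O') → Q + passed j O + m ≤ suc (Q' + passed j O')
    transfer j Q O Q' O' m O<N O'<N bound with <-cmp (Q + m) (suc Q')
    ... | tri< Q+m<1+Q' _ _ = begin
      Q + passed j O + m       ≡⟨ xy∙z≈xz∙y Q (passed j O) m ⟩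
      Q + m + passed j O       ≤⟨ +-mono-≤ (≤-pred Q+m<1+Q') (passed≤1 j O) ⟩
      Q' + 1                   ≡⟨ +-comm Q' 1 ⟩
      suc Q'                   ≤⟨ s≤s (m≤m+n Q' _) ⟩
      suc (Q' + passed j O') ∎
    ... | tri≈ _ Q+m≡1+Q' _ = begin
      Q + passed j O + m       ≡⟨ xy∙z≈xz∙y Q (passed j O) m ⟩
      Q + m + passed j O       ≡⟨ cong (_+ passed j O) Q+m≡1+Q' ⟩
      suc Q' + passed j O      ≤⟨ s≤s (+-monoʳ-≤ Q' (passed-monoʳ O≤O')) ⟩
      suc (Q' + passed j O') ∎
      where
      O≤O' : O ≤ O'
      O≤O' = +-cancelˡ-≤ (suc Q' * N) O O' (begin
        suc Q' * N + O         ≡⟨ cong (λ q → q * N + O) Q+m≡1+Q' ⟨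
        (Q + m) * N + O        ≡⟨ regroup Q O m ⟨
        Q * N + O + N * m      ≤⟨ bound ⟩
        N + (Q' * N + O')      ≡⟨ +-assoc N (Q' * N) O' ⟨
        suc Q' * N + O' ∎)
    ... | tri> _ _ 1+Q'<Q+m = ⊥-elim (<-irrefl refl (begin-strict
      N + (Q' * N + O')        <⟨ +-monoʳ-< N (+-monoʳ-< (Q' * N) O'<N) ⟩
      N + (Q' * N + N)         ≡⟨ cong (N +_) (+-comm (Q' * N) N) ⟩
      suc (suc Q') * N         ≤⟨ *-monoˡ-≤ N 1+Q'<Q+m ⟩
      (Q + m) * N              ≤⟨ m≤m+n _ O ⟩
      (Q + m) * N + O          ≡⟨ regroup Q O m ⟨
      Q * N + O + N * m        ≤⟨ bound ⟩
      N + (Q' * N + O') ∎))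

    module _ {n} (r k : ℕ) (E : List (Subset n)) (length-E : length E ≡ N)
             (stable-E : All (StableKSubset n k r) E) (j : ℕ) (j<N : j < N) where

      private
        cs : Vec ℕ n
        cs = columns E
        cs≤N : AllV (_≤ N) cs
        cs≤N = columns-bounded E length-E
        S : Subset n
        S = slot 0 j cs

      slot-bound : ∀ x x' m → prefixTotal x E + N * m ≤ N + prefixTotal x' E →
        prefix x S + m ≤ suc (prefix x' S)
      slot-bound x x' m bound =
        subst₂ (λ p p' → p + m ≤ suc p') (sym (prefix-filling cs j x j<N cs≤N)) (sym (prefix-filling cs j x' j<N cs≤N))
          (transfer j (rounds cs x) (cursor cs x) (rounds cs x') (cursor cs x') m
            (cursor<N cs x cs≤N) (cursor<N cs x' cs≤N)
            (subst₂ (λ t t' → t + N * m ≤ N + t') (sym (total x)) (sym (total x')) bound))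
        where
        total : ∀ v → rounds cs v * N + cursor cs v ≡ prefixTotal v E
        total v = trans (rounds-cursor cs v cs≤N) (partialSum-columns v E)

      summed-bound-E : ∀ x x' m → All (λ T → prefix x T + m ≤ suc (prefix x' T)) E →
        prefixTotal x E + N * m ≤ N + prefixTotal x' E
      summed-bound-E x x' m bounds =
        subst (λ l → prefixTotal x E + l * m ≤ l + prefixTotal x' E) length-E
          (summed-bound (prefix x) (prefix x') m E bounds)

      slot-size : prefix n S ≡ k
      slot-size = filling-size cs k j j<N cs≤N (begin-equality
        partialSum n cs        ≡⟨ partialSum-columns n E ⟩
        prefixTotal n E        ≡⟨ sizes E (All.map proj₁ stable-E) ⟩
        length E * k           ≡⟨ cong (_* k) length-E ⟩
        N * k                  ≡⟨ *-comm N k ⟩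
        k * N ∎)
        where
        sizes : ∀ (L : List (Subset n)) → All (KSubset n k) L → prefixTotal n L ≡ length L * k
        sizes [] [] = refl
        sizes (T ∷ L) (|T|≡k ∷ sized) = cong₂ _+_ (trans (prefix-full T) |T|≡k) (sizes L sized)

      -- a ∈ S and b ∈ S closer than r: the window [a , b] holds two elements of S,
      -- but at most one of every T ∈ E
      slot-linear-gap : ∀ a b → toℕ a < toℕ b → lookup S a ≡ true → lookup S b ≡ true →
        r ≤ toℕ b ∸ toℕ a
      slot-linear-gap a b a<b a∈S b∈S with r ≤? toℕ b ∸ toℕ a
      ... | yes far = far
      ... | no close = ⊥-elim (<-irrefl refl (begin-strict
        suc (prefix (toℕ a) S)        <⟨ prefix-two-elements S a b a<b a∈S b∈S ⟩
        prefix (suc (toℕ b)) S        ≡⟨ +-identityʳ _ ⟨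
        prefix (suc (toℕ b)) S + 0    ≤⟨ slot-bound (suc (toℕ b)) (toℕ a) 0
                                           (summed-bound-E (suc (toℕ b)) (toℕ a) 0 (All.map window stable-E)) ⟩
        suc (prefix (toℕ a) S) ∎))
        where
        window : ∀ {T} → StableKSubset n k r T → prefix (suc (toℕ b)) T + 0 ≤ suc (prefix (toℕ a) T)
        window {T} (_ , stable) = subst (_≤ suc (prefix (toℕ a) T)) (sym (+-identityʳ _))
          (window-bound T (stable⇒gapped T stable) (toℕ a) (suc (toℕ b)) (close⇒short (<⇒≤ a<b) (≰⇒> close)))

      -- a ∈ S and b ∈ S closer than r around the n-gon: the wrapping window
      -- [b , n) ∪ [0 , a] holds two elements of S, but at most one of every T ∈ E
      slot-cyclic-gap : ∀ a b → toℕ a < toℕ b → lookup S a ≡ true → lookup S b ≡ true →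
        r ≤ n ∸ (toℕ b ∸ toℕ a)
      slot-cyclic-gap a b a<b a∈S b∈S with r ≤? n ∸ (toℕ b ∸ toℕ a)
      ... | yes far = far
      ... | no close = ⊥-elim (<-irrefl refl (begin-strict
        k                             <⟨ s≤s (m≤n+m k _) ⟩
        suc (prefix (toℕ a) S + k)    ≡⟨ cong (_+ k) (prefix-step S a a∈S) ⟨
        prefix (suc (toℕ a)) S + k    ≤⟨ slot-bound (suc (toℕ a)) (toℕ b) k
                                           (summed-bound-E (suc (toℕ a)) (toℕ b) k (All.map window stable-E)) ⟩
        suc (prefix (toℕ b) S)        ≡⟨ prefix-step S b b∈S ⟨
        prefix (suc (toℕ b)) S        ≤⟨ prefix≤full S (suc (toℕ b)) ⟩
        prefix n S                    ≡⟨ slot-size ⟩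
        k ∎))
        where
        b≤n : toℕ b ≤ n
        b≤n = <⇒≤ (Finₚ.toℕ<n b)
        window : ∀ {T} → StableKSubset n k r T → prefix (suc (toℕ a)) T + k ≤ suc (prefix (toℕ b) T)
        window {T} (|T|≡k , stable) =
          subst (λ m → prefix (suc (toℕ a)) T + m ≤ suc (prefix (toℕ b) T)) (trans (prefix-full T) |T|≡k)
            (cyclic-window-bound T (stable⇒gapped T stable) (toℕ a) (toℕ b) a<b b≤n
              (close⇒wraps (<⇒≤ a<b) b≤n (≰⇒> close)))

      slot-stable : StableKSubset n k r S
      slot-stable = trans (sym (prefix-full S)) slot-size ,
        gapped⇒stable S (λ a b a<b a∈S b∈S →
          slot-linear-gap a b a<b a∈S b∈S , slot-cyclic-gap a b a<b a∈S b∈S)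

open Stability

-- Every point of the r-stable hypersimplex lies in a simplex σ_C with C a
-- sorted collection of r-stable k-sets.
--
-- Clearing denominators, a point x of the hull is the barycentre of a list
-- E of N r-stable k-sets (with repetitions).  The cyclic filling of the
-- column counts of E is a balanced list of N r-stable k-sets with the same
-- barycentre; grouping its repeated members gives the sorted collection.
module Covering where

  open import Data.Nat as ℕ using (ℕ; suc)
  import Data.Nat.Properties as ℕₚ
  open import Data.Nat.ListAction using (sum)
  open import Data.Rational using (1ℚ; _*_)
  open import Data.Rational.Properties using (*-identityˡ)
  open import Data.Bool.Properties using () renaming (_≟_ to _≟ᵇ_)
  import Data.Vec.Properties as Vecₚ
  open import Data.List.Relation.Unary.Any as Any using (here; there)
  open import Data.List.Membership.Propositional using (_∈_)
  open import Data.List.Relation.Binary.Pointwise using (Pointwise-length)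
  open import Data.List.Relation.Binary.Sublist.Propositional using (_⊆_; []; _∷_; _∷ʳ_)
  open import Data.List.Relation.Binary.Sublist.Propositional.Properties using (All-resp-⊆)
  open import Data.List.Relation.Unary.All.Properties using (applyUpTo⁺₁)

  Barycentre : ∀ {n} → ℕ → List (Subset n) → Point n → Set
  Barycentre {n} N' F x = (length F ≡ suc N') × (∀ (i : Fin n) → x i * ι (suc N') ≡ ι (column F i))

  hull-point⇒barycentre : ∀ {n} k r (x : Point n) → InConvHullOf (StableKSubset n k r) x →
    Σ ℕ λ N' → Σ (List (Subset n)) λ E → All (StableKSubset n k r) E × Barycentre N' E x
  hull-point⇒barycentre {n} k r x (Is , stable , ls , len , 0≤ls , sum≡1 , x≡) with common-denominator ls 0≤ls
  ... | N' , ms , scaled =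
    N' , expand ms Is , All-expand ms Is stable ,
    trans (length-expand ms Is lenms) total , λ i → begin
      x i * ι (suc N')                       ≡⟨ cong (_* ι (suc N')) (x≡ i) ⟩
      lincomb ls (map ε Is) i * ι (suc N')   ≡⟨ lincomb-scaled (suc N') ls ms Is i scaled ⟩
      ι (weightedColumn ms Is i)             ≡⟨ cong ι (column-expand ms Is i) ⟨
      ι (column (expand ms Is) i) ∎
    where
    open ≡-Reasoning
    lenms : length ms ≡ length Is
    lenms = trans (sym (Pointwise-length scaled)) (trans len (length-map ε Is))
    total : sum ms ≡ suc N'
    total = ι-injective (trans (sym (sum-scaled (suc N') ls ms scaled))
      (trans (cong (_* ι (suc N')) sum≡1) (*-identityˡ (ι (suc N')))))

  filling-barycentre : ∀ {n} k r N' (E : List (Subset n)) (x : Point n) →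
    All (StableKSubset n k r) E → Barycentre N' E x →
    let F = Slots.filling N' (columns E) in
    BalancedList F × All (StableKSubset n k r) F × Barycentre N' F x
  filling-barycentre {n} k r N' E x stable (length-E , x≡) =
    Slots.filling-balanced N' cs (columns-bounded E length-E) ,
    applyUpTo⁺₁ (λ j → Slots.slot N' 0 j cs) (suc N') (λ {j} j<N → slot-stable N' r k E length-E stable j j<N) ,
    Slots.length-filling N' cs ,
    λ i → trans (x≡ i) (cong ι (same-columns i))
    where
    cs : Vec ℕ n
    cs = columns E
    same-columns : ∀ i → column E i ≡ column (Slots.filling N' cs) i
    same-columns = prefixTotals⇒columns E (Slots.filling N' cs)
      (λ v → sym (trans (Slots.filling-prefixTotal N' cs v (columns-bounded E length-E)) (partialSum-columns v E)))

  bump : ∀ {n} {x : Subset n} {D : List (Subset n)} → x ∈ D → List ℕ → List ℕ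
  bump _ [] = []
  bump (here _) (w ∷ ws) = suc w ∷ ws
  bump (there x∈D) (w ∷ ws) = w ∷ bump x∈D ws

  length-bump : ∀ {n} {x : Subset n} {D} (x∈D : x ∈ D) ws → length (bump x∈D ws) ≡ length ws
  length-bump _ [] = refl
  length-bump (here _) (w ∷ ws) = refl
  length-bump (there x∈D) (w ∷ ws) = cong suc (length-bump x∈D ws)

  sum-bump : ∀ {n} {x : Subset n} {D} (x∈D : x ∈ D) ws → length ws ≡ length D →
    sum (bump x∈D ws) ≡ suc (sum ws)
  sum-bump (here _) (w ∷ ws) _ = refl
  sum-bump (there x∈D) (w ∷ ws) len =
    trans (cong (w ℕ.+_) (sum-bump x∈D ws (ℕₚ.suc-injective len))) (ℕₚ.+-suc w (sum ws))

  weightedColumn-bump : ∀ {n} {x : Subset n} {D} (x∈D : x ∈ D) ws i → length ws ≡ length D →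
    weightedColumn (bump x∈D ws) D i ≡ bit (lookup x i) ℕ.+ weightedColumn ws D i
  weightedColumn-bump {x = x} (here refl) (w ∷ ws) i _ =
    ℕₚ.+-assoc (bit (lookup x i)) (w ℕ.* bit (lookup x i)) _
  weightedColumn-bump {x = x} {y ∷ D} (there x∈D) (w ∷ ws) i len =
    trans (cong (w ℕ.* bit (lookup y i) ℕ.+_) (weightedColumn-bump x∈D ws i (ℕₚ.suc-injective len)))
      (x∙yz≈y∙xz (w ℕ.* bit (lookup y i)) (bit (lookup x i)) _)
    where open import Algebra.Properties.CommutativeSemigroup ℕₚ.+-commutativeSemigroup using (x∙yz≈y∙xz)

  group-duplicates : ∀ {n} (F : List (Subset n)) → Σ (List (Subset n)) λ D → Σ (List ℕ) λ ws →
    (D ⊆ F) × AllPairs _≢_ D × (length ws ≡ length D) × (sum ws ≡ length F) ×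
    (∀ i → weightedColumn ws D i ≡ column F i)
  group-duplicates [] = [] , [] , [] , [] , refl , refl , λ i → refl
  group-duplicates (x ∷ F) with group-duplicates F
  ... | D , ws , D⊆F , distinct , len , total , cols with Any.any? (Vecₚ.≡-dec _≟ᵇ_ x) D
  ...   | yes x∈D = D , bump x∈D ws , x ∷ʳ D⊆F , distinct , trans (length-bump x∈D ws) len ,
          trans (sum-bump x∈D ws len) (cong suc total) ,
          λ i → trans (weightedColumn-bump x∈D ws i len) (cong (bit (lookup x i) ℕ.+_) (cols i))
  ...   | no x∉D = x ∷ D , 1 ∷ ws , refl ∷ D⊆F ,
          All.tabulate (λ {y} y∈D x≡y → x∉D (subst (_∈ D) (sym x≡y) y∈D)) ∷ distinct ,
          cong suc len , cong suc total ,
          λ i → cong₂ ℕ._+_ (ℕₚ.*-identityˡ (bit (lookup x i))) (cols i)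

  balanced⇒sortedCollection : ∀ {n k} (D : List (Subset n)) → All (KSubset n k) D →
    AllPairs _≢_ D → BalancedList D → SortedCollection n k D
  balanced⇒sortedCollection D sized distinct bal = sized , pairs D sized distinct bal
    where
    pairs : ∀ {n k} (D : List (Subset n)) → All (KSubset n k) D → AllPairs _≢_ D → BalancedList D →
      AllPairs (λ I J → (I ≢ J) × SortedPair I J) D
    pairs [] [] [] [] = []
    pairs (I ∷ D) (|I| ∷ sized) (I≢D ∷ distinct) (I~D ∷ bal) =
      later D sized I≢D I~D ∷ pairs D sized distinct bal
      where
      later : ∀ D → All (KSubset _ _) D → All (I ≢_) D → All (Balanced I) D →
        All (λ J → (I ≢ J) × SortedPair I J) D
      later [] [] [] [] = []
      later (J ∷ D) (|J| ∷ sized) (I≢J ∷ I≢D) (I~J ∷ I~D) =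
        (I≢J , balanced⇒sorted I J (trans |I| (sym |J|)) I~J) ∷ later D sized I≢D I~D

  barycentre⇒simplex : ∀ {n} k r N' (F : List (Subset n)) (x : Point n) →
    BalancedList F → All (StableKSubset n k r) F → Barycentre N' F x →
    Σ (List (Subset n)) λ C → StableSortedCollection n k r C × InConv (map ε C) x
  barycentre⇒simplex {n} k r N' F x bal stable (length-F , x≡) with group-duplicates F
  ... | D , ws , D⊆F , distinct , len , total , cols =
    D , (balanced⇒sortedCollection D (All.map proj₁ stable-D) distinct (AllPairs-resp-⊆ D⊆F bal) , stable-D) ,
    divideBy N' ws , weights-length , divideBy-nonneg N' ws , weights-sum , coordinates
    where
    stable-D : All (StableKSubset n k r) D
    stable-D = All-resp-⊆ D⊆F stable
    weights-length : length (divideBy N' ws) ≡ length (map ε D)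
    weights-length = trans (length-map _ ws) (trans len (sym (length-map ε D)))
    weights-sum : sumℚ (divideBy N' ws) ≡ 1ℚ
    weights-sum = ι-cancelʳ _ _ N' (trans (sum-scaled (suc N') _ ws (divideBy-scaled N' ws))
      (trans (cong ι (trans total length-F)) (sym (*-identityˡ (ι (suc N'))))))
    coordinates : ∀ i → x i ≡ lincomb (divideBy N' ws) (map ε D) i
    coordinates i = ι-cancelʳ _ _ N' (trans (x≡ i) (trans (cong ι (sym (cols i)))
      (sym (lincomb-scaled (suc N') (divideBy N' ws) ws D i (divideBy-scaled N' ws)))))

  covering : ∀ {n} k r (x : Point n) → InConvHullOf (StableKSubset n k r) x →
    Σ (List (Subset n)) λ C → StableSortedCollection n k r C × InConv (map ε C) x
  covering k r x in-hull with hull-point⇒barycentre k r x in-hull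
  ... | N' , E , stable-E , barycentre-E with filling-barycentre k r N' E x stable-E barycentre-E
  ...   | bal , stable-F , barycentre-F = barycentre⇒simplex k r N' _ x bal stable-F barycentre-F

open Covering

open import Data.Nat using (ℕ; _≤_; _<_; NonZero; _/_)

-- The hypotheses k < n and 1 ≤ r ≤ n/k guarantee that r-stable k-subsets
-- exist; the argument does not need them.
theorem1p1 : (n k r : ℕ) → .{{_ : NonZero k}} → k < n → 1 ≤ r → r ≤ n / k →
    IsTriangulation n (StableKSubset n k r) (StableSortedCollection n k r)
theorem1p1 n k r _ _ _ = record
  { vertices-in = λ C → proj₂
  ; simplex     = λ C ((_ , sorted) , _) →
      affinely-independent C (AllPairs.map proj₁ sorted) (sorted⇒balancedList C sorted)
  ; face-closed = stable-sorted-⊆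
  ; covers      = λ x → covering k r x
  ; intersect   = λ C C' x ((_ , sorted) , _) ((_ , sorted') , _) →
      common-face C C' x (sorted⇒balancedList C sorted) (sorted⇒balancedList C' sorted')
  }
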